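{- Let $n\ge1$, $m=3^{n-1}$, and let $T$ (the 2-regular caterpillar) be the tree with backbone path $v_1\cdots v_m$ in which each $v_r$ has exactly two additional pendant leaves $\ell_r,\ell_r'$. Let $lex:V(Q_n^3)\to V(T)$ send the vertex $(x_{n-1},\dots,x_0)$ with $N=\sum_i x_i3^i=3(r-1)+a$ ($a\in\{0,1,2\}$) to $v_r$ if $a=0$, to $\ell_r$ if $a=1$, and to $\ell_r'$ if $a=2$. Then $WL_{lex}(Q_n^3,T)=WL(Q_n^3,T)$, i.e. this embedding has minimum wirelength.
   Context: $Q_n^3$ is the graph on $\{0,1,2\}^n$ in which two tuples are adjacent iff they differ in exactly one coordinate $j$ and there $x_j\equiv y_j\pm1\pmod 3$. For a bijection $f:V(G)\to V(T)$ into a tree $T$, each edge $(u,v)$ of $G$ is routed along the unique path in $T$ between $f(u)$ and $f(v)$; $WL_f(G,T)$ is the sum over edges of $G$ of the lengths of these paths (equivalently the sum over edges $e$ of $T$ of the number of routed paths containing $e$), and $WL(G,T)$ is the minimum of $WL_f(G,T)$ over all bijections $f$. -}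

module Defs where

open import Data.Nat using (ℕ; zero; suc; _+_; _*_; _^_; ∣_-_∣)
open import Data.Bool using (Bool; true; false; if_then_else_; _∧_; _∨_)
open import Data.Fin using (Fin; zero; suc; toℕ; combine)
open import Data.Fin.Properties using (_≟_)
open import Data.Vec using (Vec; []; _∷_; init; last)
open import Data.List using (List; []; _∷_; _++_; map; concatMap; filter; allFin; length)
open import Data.Nat.ListAction using (sum)
open import Data.Product using (_×_; _,_; proj₁; proj₂)
open import Relation.Nullary.Decidable using (⌊_⌋)

-- A vertex (x_{n-1}, ..., x_0) of Q_n^3; the head of the vector is x_{n-1}.
Vertex : ℕ → Set
Vertex n = Vec (Fin 3) n

allVertices : (n : ℕ) → List (Vertex n)
allVertices zero    = [] ∷ []
allVertices (suc n) = concatMap (λ x → map (x ∷_) (allVertices n)) (allFin 3)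

suc3 : Fin 3 → Fin 3
suc3 zero = suc zero
suc3 (suc zero) = suc (suc zero)
suc3 (suc (suc zero)) = zero

eqᵇ : Fin 3 → Fin 3 → Bool
eqᵇ a b = ⌊ a ≟ b ⌋

numDiff : ∀ {n} → Vertex n → Vertex n → ℕ
numDiff [] [] = 0
numDiff (x ∷ xs) (y ∷ ys) = (if eqᵇ x y then 0 else 1) + numDiff xs ys

diffsPM1 : ∀ {n} → Vertex n → Vertex n → Bool
diffsPM1 [] [] = true
diffsPM1 (x ∷ xs) (y ∷ ys) =
  (eqᵇ x y ∨ eqᵇ x (suc3 y) ∨ eqᵇ y (suc3 x)) ∧ diffsPM1 xs ys

isOne : ℕ → Bool
isOne (suc zero) = true
isOne _ = false

adjQ : ∀ {n} → Vertex n → Vertex n → Bool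
adjQ u v = isOne (numDiff u v) ∧ diffsPM1 u v

pairs : {A : Set} → List A → List (A × A)
pairs [] = []
pairs (x ∷ xs) = map (x ,_) xs ++ pairs xs

edgesQ : (n : ℕ) → List (Vertex n × Vertex n)
edgesQ n = filter (λ e → adjQ (proj₁ e) (proj₂ e) Data.Bool.≟ true) (pairs (allVertices n))
  where import Data.Bool

-- The 2-regular caterpillar T with backbone v_1 ... v_m.
-- Vertex (i , a) with i : Fin m stands for r = i + 1 and
--   a = 0 : the backbone vertex v_r,  a = 1 : leaf ℓ_r,  a = 2 : leaf ℓ'_r.

TVertex : ℕ → Set
TVertex m = Fin m × Fin 3

isLeaf : Fin 3 → ℕ
isLeaf zero = 0
isLeaf (suc _) = 1

distT : ∀ {m} → TVertex m → TVertex m → ℕ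
distT (i , a) (j , b) =
  if ⌊ i ≟ j ⌋ ∧ eqᵇ a b then 0
  else ∣ toℕ i - toℕ j ∣ + isLeaf a + isLeaf b

WL : ∀ {n m} → (Vertex n → TVertex m) → ℕ
WL {n} f = sum (map (λ e → distT (f (proj₁ e)) (f (proj₂ e))) (edgesQ n))

-- The lexicographic embedding, for n = suc k, m = 3^k.
-- (x_{n-1},...,x_0) with N = Σ x_i 3^i = 3(r-1) + a is sent to (r-1 , a).

toFin3 : ∀ {k} → Vertex k → Fin (3 ^ k)
toFin3 [] = zero
toFin3 (x ∷ xs) = combine x (toFin3 xs)

lex : ∀ {k} → Vertex (suc k) → TVertex (3 ^ k)
lex v = toFin3 (init v) , last v

module Submission where

open import Defs
open import Data.Nat using (ℕ; suc; _^_; _≤_)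
open import Function.Bundles using (_⤖_; Bijection)

open import Data.Bool using (Bool; true; false; if_then_else_; _∧_)
import Data.Bool as Bool
open import Data.Bool.Properties using (∧-zeroʳ)
open import Data.Fin using (Fin; zero; suc; toℕ; combine; remQuot)
import Data.Fin.Properties as Fin
open import Data.Fin.Properties using (toℕ<n; toℕ-combine; combine-injectiveˡ; combine-injectiveʳ; combine-remQuot)
open import Data.List using (List; []; _∷_; _++_; map; filter)
open import Data.List.Properties using (map-++; map-cong; map-∘)
open import Data.List.Relation.Unary.All as All using (All)
open import Data.List.Relation.Unary.All.Properties using (all-filter)
open import Data.Nat
open import Data.Nat.Induction using (<-wellFounded)
open import Data.Nat.ListAction using (sum)
open import Data.Nat.ListAction.Properties using (sum-++)
open import Data.Nat.Properties
open import Data.Nat.Tactic.RingSolver using (solve-∀; solve)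
open import Data.Product using (_×_; _,_; proj₁; proj₂)
open import Data.Sum using (_⊎_; inj₁; inj₂)
open import Data.Vec using ([]; _∷_; init; last; _∷ʳ_; initLast)
open import Data.Vec.Properties using (≡-dec; init-∷ʳ; last-∷ʳ)
open import Function using (_∘_; mk⤖; mk⇔)
open import Function.Consequences.Propositional using (strictlySurjective⇒surjective)
open import Function.Definitions using (Injective; StrictlySurjective)
open import Induction.WellFounded using (Acc; acc)
open import Relation.Binary.Definitions using (DecidableEquality)
open import Relation.Binary.PropositionalEquality
open import Relation.Nullary using (does; yes; no; contradiction)
open import Relation.Nullary.Decidable using (dec-true; dec-false; does-⇔; _×-dec_)
open import Algebra.Properties.CommutativeSemigroup +-commutativeSemigroup using (interchange; x∙yz≈y∙xz)

-- Count the wirelength edge by edge of T. The pendant edge at a leaf p is used by the 2n edges of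
-- Q_n^3 at the preimage of p. The backbone edge between columns t - 1 and t is used by the edges
-- leaving the preimage S_t of the first t columns; as Q_n^3 is 2n-regular and |S_t| = 3t, there are
-- 6nt - 2 E(S_t) of them, where E(S) counts the edges inside S. Hence WL_f + 2 Σ_t E(S_t) is the same
-- for every bijection f, and it suffices that lex maximises every E(S_t).
--
-- That is Lindsey's theorem: s vertices of Q_n^3 induce at most F(s) = Σ_{i<s} digitSum i edges
-- (digit sums in base 3), with equality for lexicographic initial segments, and every S_t of lex is one.
-- The upper bound is by induction on n over the three layers x ∷ Q_{n-1}^3; it needs
-- F a + F b + F c + (a ⊓ b + a ⊓ c + b ⊓ c) ≤ F (a + b + c), which follows by splitting a, b, c
-- by residues mod 3 until the triple is nearly balanced.

-- Base-3 digit sums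

-- Base-3 digits, least significant first.
increment : List (Fin 3) → List (Fin 3)
increment []                   = suc zero ∷ []
increment (zero ∷ ds)          = suc zero ∷ ds
increment (suc zero ∷ ds)      = suc (suc zero) ∷ ds
increment (suc (suc zero) ∷ ds) = zero ∷ increment ds

ternary : ℕ → List (Fin 3)
ternary zero    = []
ternary (suc n) = increment (ternary n)

digitSum : ℕ → ℕ
digitSum n = sum (map toℕ (ternary n))

digitSumsBelow : ℕ → ℕ
digitSumsBelow zero    = 0
digitSumsBelow (suc n) = digitSumsBelow n + digitSum n

triple : ℕ → ℕ
triple zero    = zero
triple (suc m) = suc (suc (suc (triple m)))

triple≡3* : ∀ m → triple m ≡ 3 * m
triple≡3* zero    = refl
triple≡3* (suc m) = trans (cong (3 +_) (triple≡3* m)) (sym (*-suc 3 m))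

data Residue3 : ℕ → Set where
  3*_+0 : ∀ m → Residue3 (triple m)
  3*_+1 : ∀ m → Residue3 (suc (triple m))
  3*_+2 : ∀ m → Residue3 (suc (suc (triple m)))

residue3 : ∀ n → Residue3 n
residue3 zero = 3* zero +0
residue3 (suc n) with residue3 n
... | 3* m +0 = 3* m +1
... | 3* m +1 = 3* m +2
... | 3* m +2 = 3* suc m +0

ternary-triple : ∀ m → ternary (suc (triple m)) ≡ suc zero ∷ ternary m
                     × ternary (suc (suc (triple m))) ≡ suc (suc zero) ∷ ternary m
                     × ternary (triple (suc m)) ≡ zero ∷ ternary (suc m)
ternary-triple zero = refl , refl , refl
ternary-triple (suc m) with ternary-triple m
... | _ , _ , t₀ = t₁ , t₂ , cong increment t₂
  where
  t₁ = cong increment t₀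
  t₂ = cong increment t₁

digitSum-triple : ∀ m → digitSum (triple m) ≡ digitSum m
digitSum-triple zero    = refl
digitSum-triple (suc m) with ternary-triple m
... | _ , _ , t₀ = cong (λ ds → sum (map toℕ ds)) t₀

digitSum-triple+1 : ∀ m → digitSum (suc (triple m)) ≡ suc (digitSum m)
digitSum-triple+1 m with ternary-triple m
... | t₁ , _ = cong (λ ds → sum (map toℕ ds)) t₁

digitSum-triple+2 : ∀ m → digitSum (suc (suc (triple m))) ≡ 2 + digitSum m
digitSum-triple+2 m with ternary-triple m
... | _ , t₂ , _ = cong (λ ds → sum (map toℕ ds)) t₂

digitSum-suc-≤ : ∀ n → digitSum (suc n) ≤ suc (digitSum n)
digitSum-suc-≤ n = increment-≤ (ternary n)
  where
  increment-≤ : ∀ ds → sum (map toℕ (increment ds)) ≤ suc (sum (map toℕ ds))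
  increment-≤ []                    = ≤-refl
  increment-≤ (zero ∷ ds)           = ≤-refl
  increment-≤ (suc zero ∷ ds)       = ≤-refl
  increment-≤ (suc (suc zero) ∷ ds) = ≤-trans (increment-≤ ds) (s≤s (m≤n+m _ 2))

digitSumsBelow-triple : ∀ m → digitSumsBelow (triple m) ≡ 3 * digitSumsBelow m + 3 * m
digitSumsBelow-triple zero = refl
digitSumsBelow-triple (suc m)
  rewrite digitSumsBelow-triple m | digitSum-triple m | digitSum-triple+1 m | digitSum-triple+2 m
  = e (digitSumsBelow m) (digitSum m) m
  where
  e : ∀ f s m → 3 * f + 3 * m + s + suc s + (2 + s) ≡ 3 * (f + s) + 3 * suc m
  e = solve-∀

sumBelow : ℕ → (ℕ → ℕ) → ℕ
sumBelow zero    f = 0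
sumBelow (suc n) f = sumBelow n f + f n

sumBelow-cong : ∀ n {f g : ℕ → ℕ} → (∀ i → i < n → f i ≡ g i) → sumBelow n f ≡ sumBelow n g
sumBelow-cong zero    f≗g = refl
sumBelow-cong (suc n) f≗g =
  cong₂ _+_ (sumBelow-cong n (λ i i<n → f≗g i (m<n⇒m<1+n i<n))) (f≗g n ≤-refl)

sumBelow-mono : ∀ n {f g : ℕ → ℕ} → (∀ i → i < n → f i ≤ g i) → sumBelow n f ≤ sumBelow n g
sumBelow-mono zero    f≤g = z≤n
sumBelow-mono (suc n) f≤g = +-mono-≤ (sumBelow-mono n (λ i i<n → f≤g i (m<n⇒m<1+n i<n))) (f≤g n ≤-refl)

digitSumsBelow-+ : ∀ k z → digitSumsBelow (k + z) ≡ digitSumsBelow z + sumBelow k (λ i → digitSum (i + z))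
digitSumsBelow-+ zero    z = sym (+-identityʳ _)
digitSumsBelow-+ (suc k) z = trans (cong (_+ digitSum (k + z)) (digitSumsBelow-+ k z)) (+-assoc (digitSumsBelow z) _ _)

triad : ℕ → ℕ → ℕ → ℕ → ℕ
triad s₀ s₁ s₂ zero          = s₀
triad s₀ s₁ s₂ (suc zero)    = s₁
triad s₀ s₁ s₂ (suc (suc _)) = s₂

spread : (ℕ → ℕ) → ℕ → ℕ
spread d i = i % 3 + d (i / 3)

-- Applied to s_j = digitSum (j + w): then spread lists the digit sums just above 3w
-- (digitSum-above-triple), and s_{j+1} ≤ suc s_j.
module _ {s₀ s₁ s₂ : ℕ} (s₁≤ : s₁ ≤ suc s₀) (s₂≤ : s₂ ≤ suc s₁) where
  open ≤-Reasoning
  private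
    vars : List ℕ
    vars = s₀ ∷ s₁ ∷ s₂ ∷ []
    d = triad s₀ s₁ s₂
    s₂≤′ : s₂ ≤ 2 + s₀
    s₂≤′ = ≤-trans s₂≤ (s≤s s₁≤)

  window-merge : ∀ n₁ n₂ → n₂ ≤ n₁ → n₁ ≤ 3 →
                 sumBelow n₁ d + sumBelow n₂ d + n₂ ≤ sumBelow (n₁ + n₂) (spread d)
  window-merge 0 0 _ _ = z≤n
  window-merge 1 0 _ _ = begin s₀ + 0 + 0 ≡⟨ solve vars ⟩ s₀ ∎
  window-merge 1 1 _ _ = begin s₀ + s₀ + 1 ≡⟨ solve vars ⟩ s₀ + suc s₀ ∎
  window-merge 2 0 _ _ = begin
    s₀ + s₁ + 0 + 0   ≡⟨ solve vars ⟩
    s₀ + s₁           ≤⟨ +-monoʳ-≤ s₀ s₁≤ ⟩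
    s₀ + suc s₀       ∎
  window-merge 2 1 _ _ = begin
    s₀ + s₁ + s₀ + 1              ≡⟨ solve vars ⟩
    s₀ + suc s₀ + s₁              ≤⟨ +-monoʳ-≤ _ (m≤n⇒m≤1+n s₁≤) ⟩
    s₀ + suc s₀ + (2 + s₀)        ∎
  window-merge 2 2 _ _ = begin
    s₀ + s₁ + (s₀ + s₁) + 2       ≡⟨ solve vars ⟩
    s₀ + suc s₀ + s₁ + suc s₁     ≤⟨ +-monoʳ-≤ _ (s≤s s₁≤) ⟩
    s₀ + suc s₀ + s₁ + (2 + s₀)   ≡⟨ solve vars ⟩
    s₀ + suc s₀ + (2 + s₀) + s₁   ∎
  window-merge 3 0 _ _ = begin
    s₀ + s₁ + s₂ + 0 + 0          ≡⟨ solve vars ⟩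
    s₀ + (s₁ + s₂)                ≤⟨ +-monoʳ-≤ s₀ (+-mono-≤ s₁≤ s₂≤′) ⟩
    s₀ + (suc s₀ + (2 + s₀))      ≡⟨ solve vars ⟩
    s₀ + suc s₀ + (2 + s₀)        ∎
  window-merge 3 1 _ _ = begin
    s₀ + s₁ + s₂ + s₀ + 1               ≡⟨ solve vars ⟩
    s₀ + suc s₀ + s₁ + s₂               ≤⟨ +-monoʳ-≤ _ s₂≤′ ⟩
    s₀ + suc s₀ + s₁ + (2 + s₀)         ≡⟨ solve vars ⟩
    s₀ + suc s₀ + (2 + s₀) + s₁         ∎
  window-merge 3 2 _ _ = begin
    s₀ + s₁ + s₂ + (s₀ + s₁) + 2             ≡⟨ solve vars ⟩
    s₀ + suc s₀ + s₁ + suc s₁ + s₂           ≤⟨ +-monoʳ-≤ _ s₂≤′ ⟩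
    s₀ + suc s₀ + s₁ + suc s₁ + (2 + s₀)     ≡⟨ solve vars ⟩
    s₀ + suc s₀ + (2 + s₀) + s₁ + suc s₁     ∎
  window-merge 3 3 _ _ = begin
    s₀ + s₁ + s₂ + (s₀ + s₁ + s₂) + 3                  ≡⟨ solve vars ⟩
    2 * s₀ + 2 * s₁ + 3 + (s₂ + s₂)                    ≤⟨ +-monoʳ-≤ _ (+-mono-≤ s₂≤ s₂≤′) ⟩
    2 * s₀ + 2 * s₁ + 3 + (suc s₁ + (2 + s₀))          ≡⟨ solve vars ⟩
    s₀ + suc s₀ + (2 + s₀) + s₁ + suc s₁ + (2 + s₁)    ∎
  window-merge 0 (suc _) ()
  window-merge 1 (suc (suc _)) (s≤s ())
  window-merge 2 (suc (suc (suc _))) (s≤s (s≤s ()))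
  window-merge 3 (suc (suc (suc (suc _)))) (s≤s (s≤s (s≤s ())))
  window-merge (suc (suc (suc (suc _)))) _ _ (s≤s (s≤s (s≤s ())))

digitSum-above-triple : ∀ w i → i < 6 →
  digitSum (i + triple w) ≡ spread (triad (digitSum w) (digitSum (1 + w)) (digitSum (2 + w))) i
digitSum-above-triple w 0 _ = digitSum-triple w
digitSum-above-triple w 1 _ = digitSum-triple+1 w
digitSum-above-triple w 2 _ = digitSum-triple+2 w
digitSum-above-triple w 3 _ = digitSum-triple (suc w)
digitSum-above-triple w 4 _ = digitSum-triple+1 (suc w)
digitSum-above-triple w 5 _ = digitSum-triple+2 (suc w)
digitSum-above-triple w (suc (suc (suc (suc (suc (suc _)))))) (s≤s (s≤s (s≤s (s≤s (s≤s (s≤s ()))))))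

digitSum-above : ∀ w i → i < 3 → digitSum (i + w) ≡ triad (digitSum w) (digitSum (1 + w)) (digitSum (2 + w)) i
digitSum-above w 0 _ = refl
digitSum-above w 1 _ = refl
digitSum-above w 2 _ = refl
digitSum-above w (suc (suc (suc _))) (s≤s (s≤s (s≤s ())))

digitSumsBelow-nearlyBalanced : ∀ w n₁ n₂ → n₂ ≤ n₁ → n₁ ≤ 3 →
  digitSumsBelow (n₁ + w) + digitSumsBelow (n₂ + w) + digitSumsBelow w + ((n₂ + w) + 2 * w)
    ≤ digitSumsBelow ((n₁ + n₂) + triple w)
digitSumsBelow-nearlyBalanced w n₁ n₂ n₂≤n₁ n₁≤3 = begin
  F (n₁ + w) + F (n₂ + w) + F w + ((n₂ + w) + 2 * w)
    ≡⟨ cong₂ (λ x y → x + y + F w + ((n₂ + w) + 2 * w)) (Fwindow n₁ n₁≤3) (Fwindow n₂ (≤-trans n₂≤n₁ n₁≤3)) ⟩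
  F w + W n₁ + (F w + W n₂) + F w + ((n₂ + w) + 2 * w)
    ≡⟨ regroup (F w) (W n₁) (W n₂) n₂ w ⟩
  3 * F w + 3 * w + (W n₁ + W n₂ + n₂)
    ≤⟨ +-monoʳ-≤ _ (window-merge (digitSum-suc-≤ w) (digitSum-suc-≤ (suc w)) n₁ n₂ n₂≤n₁ n₁≤3) ⟩
  3 * F w + 3 * w + sumBelow (n₁ + n₂) (spread d)
    ≡⟨ cong₂ _+_ (sym (digitSumsBelow-triple w)) (sumBelow-cong (n₁ + n₂) (λ i i< →
         sym (digitSum-above-triple w i (≤-trans i< (+-mono-≤ n₁≤3 (≤-trans n₂≤n₁ n₁≤3)))))) ⟩
  F (triple w) + sumBelow (n₁ + n₂) (λ i → digitSum (i + triple w))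
    ≡⟨ digitSumsBelow-+ (n₁ + n₂) (triple w) ⟨
  F ((n₁ + n₂) + triple w) ∎
  where
  open ≤-Reasoning
  F = digitSumsBelow
  d = triad (digitSum w) (digitSum (1 + w)) (digitSum (2 + w))
  W : ℕ → ℕ
  W n = sumBelow n d
  regroup : ∀ f a b n w → f + a + (f + b) + f + ((n + w) + 2 * w) ≡ 3 * f + 3 * w + (a + b + n)
  regroup = solve-∀
  Fwindow : ∀ n → n ≤ 3 → F (n + w) ≡ F w + W n
  Fwindow n n≤3 = trans (digitSumsBelow-+ n w) (cong (F w +_)
    (sumBelow-cong n (λ i i<n → digitSum-above w i (≤-trans i<n n≤3))))

-- part_r x is the number of i < x with i ≡ r (mod 3).
part₀ part₁ part₂ : ℕ → ℕ
part₀ zero    = 0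
part₀ (suc x) = suc (part₂ x)
part₁ zero    = 0
part₁ (suc x) = part₀ x
part₂ zero    = 0
part₂ (suc x) = part₁ x

parts-triple : ∀ m → part₀ (triple m) ≡ m × part₁ (triple m) ≡ m × part₂ (triple m) ≡ m
parts-triple zero = refl , refl , refl
parts-triple (suc m) with parts-triple m
... | p₀ , p₁ , p₂ = cong suc p₀ , cong suc p₁ , cong suc p₂

parts-mono : ∀ {x y} → x ≤ y → part₀ x ≤ part₀ y × part₁ x ≤ part₁ y × part₂ x ≤ part₂ y
parts-mono z≤n = z≤n , z≤n , z≤n
parts-mono (s≤s x≤y) with parts-mono x≤y
... | p₀ , p₁ , p₂ = s≤s p₂ , p₀ , p₁

parts-sum : ∀ x → part₀ x + part₁ x + part₂ x ≡ x
parts-sum zero    = refl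
parts-sum (suc x) = trans (e (part₀ x) (part₁ x) (part₂ x)) (cong suc (parts-sum x))
  where
  e : ∀ a b c → suc c + a + b ≡ suc (a + b + c)
  e = solve-∀

record PartsShape (x : ℕ) : Set where
  field
    excess₀ excess₁ : ℕ
    excess₁≤excess₀ : excess₁ ≤ excess₀
    excess₀≤1       : excess₀ ≤ 1
    part₀≡          : part₀ x ≡ excess₀ + part₂ x
    part₁≡          : part₁ x ≡ excess₁ + part₂ x

partsShape : ∀ x → PartsShape x
partsShape x with residue3 x
... | 3* m +0 with parts-triple m
...   | p₀ , p₁ , p₂ = record
  { excess₀ = 0 ; excess₁ = 0 ; excess₁≤excess₀ = z≤n ; excess₀≤1 = z≤n
  ; part₀≡ = trans p₀ (sym p₂) ; part₁≡ = trans p₁ (sym p₂) }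
partsShape x | 3* m +1 with parts-triple m
...   | p₀ , p₁ , p₂ = record
  { excess₀ = 1 ; excess₁ = 0 ; excess₁≤excess₀ = z≤n ; excess₀≤1 = ≤-refl
  ; part₀≡ = cong suc (trans p₂ (sym p₁)) ; part₁≡ = trans p₀ (sym p₁) }
partsShape x | 3* m +2 with parts-triple m
...   | p₀ , p₁ , p₂ = record
  { excess₀ = 1 ; excess₁ = 1 ; excess₁≤excess₀ = ≤-refl ; excess₀≤1 = ≤-refl
  ; part₀≡ = cong suc (trans p₁ (sym p₀)) ; part₁≡ = cong suc (trans p₂ (sym p₀)) }

-- The i < x split by residue into 3q + r with q < part_r x, and digitSum (3q + r) ≡ digitSum q + r.
digitSumsBelow-parts : ∀ x → digitSumsBelow x ≡
  digitSumsBelow (part₀ x) + digitSumsBelow (part₁ x) + digitSumsBelow (part₂ x) + (part₁ x + 2 * part₂ x)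
digitSumsBelow-parts x with residue3 x
... | 3* m +0 with parts-triple m
...   | p₀ , p₁ , p₂ rewrite p₀ | p₁ | p₂ | digitSumsBelow-triple m = e (digitSumsBelow m) m
  where
  e : ∀ f m → 3 * f + 3 * m ≡ f + f + f + (m + 2 * m)
  e = solve-∀
digitSumsBelow-parts x | 3* m +1 with parts-triple m
...   | p₀ , p₁ , p₂ rewrite p₀ | p₁ | p₂ | digitSumsBelow-triple m | digitSum-triple m =
  e (digitSumsBelow m) (digitSum m) m
  where
  e : ∀ f s m → 3 * f + 3 * m + s ≡ (f + s) + f + f + (m + 2 * m)
  e = solve-∀
digitSumsBelow-parts x | 3* m +2 with parts-triple m
...   | p₀ , p₁ , p₂ rewrite p₀ | p₁ | p₂ | digitSumsBelow-triple m | digitSum-triple m | digitSum-triple+1 m =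
  e (digitSumsBelow m) (digitSum m) m
  where
  e : ∀ f s m → 3 * f + 3 * m + s + suc s ≡ (f + s) + (f + s) + f + (suc m + 2 * m)
  e = solve-∀

⊓-parts : ∀ a b → a ⊓ b ≡ part₀ a ⊓ part₀ b + part₁ a ⊓ part₁ b + part₂ a ⊓ part₂ b
⊓-parts a b = begin
  a ⊓ b                                                            ≡⟨ parts-sum (a ⊓ b) ⟨
  part₀ (a ⊓ b) + part₁ (a ⊓ b) + part₂ (a ⊓ b)                    ≡⟨ cong₂ _+_ (cong₂ _+_
                                                                        (mono-≤-distrib-⊓ (proj₁ ∘ parts-mono) a b)
                                                                        (mono-≤-distrib-⊓ (proj₁ ∘ proj₂ ∘ parts-mono) a b))
                                                                        (mono-≤-distrib-⊓ (proj₂ ∘ proj₂ ∘ parts-mono) a b) ⟩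
  part₀ a ⊓ part₀ b + part₁ a ⊓ part₁ b + part₂ a ⊓ part₂ b        ∎
  where open ≡-Reasoning

partsShape-total : ∀ x → let open PartsShape (partsShape x) in x ≡ (excess₀ + excess₁) + 3 * part₂ x
partsShape-total x = begin
  x                                                  ≡⟨ parts-sum x ⟨
  part₀ x + part₁ x + part₂ x                        ≡⟨ cong₂ (λ u v → u + v + part₂ x) part₀≡ part₁≡ ⟩
  (excess₀ + part₂ x) + (excess₁ + part₂ x) + part₂ x ≡⟨ e excess₀ excess₁ (part₂ x) ⟩
  (excess₀ + excess₁) + 3 * part₂ x                  ∎
  where
  open ≡-Reasoning
  open PartsShape (partsShape x)
  e : ∀ a b q → (a + q) + (b + q) + q ≡ (a + b) + 3 * q
  e = solve-∀

parts-ordered : ∀ x → part₂ x ≤ part₁ x × part₁ x ≤ part₀ x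
parts-ordered x =
    subst (part₂ x ≤_) (sym part₁≡) (m≤n+m _ _)
  , subst₂ _≤_ (sym part₁≡) (sym part₀≡) (+-monoˡ-≤ _ excess₁≤excess₀)
  where open PartsShape (partsShape x)

part₀≤ : ∀ x → part₀ x ≤ x
part₀≤ x = subst (part₀ x ≤_) (parts-sum x) (≤-trans (m≤m+n _ _) (m≤m+n _ _))

part₀< : ∀ x → 2 ≤ x → part₀ x < x
part₀< (suc zero)    (s≤s ())
part₀< (suc (suc x)) _ = s≤s (s≤s (≤-trans (proj₂ (parts-ordered x)) (part₀≤ x)))

+-shuffle : ∀ x y z u v w → (x + u) + ((y + v) + (z + w)) ≡ (x + (y + z)) + (u + (v + w))
+-shuffle = solve-∀

+-transpose₃ : ∀ a₀ a₁ a₂ b₀ b₁ b₂ c₀ c₁ c₂ →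
  (a₀ + a₁ + a₂) + ((b₀ + b₁ + b₂) + (c₀ + c₁ + c₂)) ≡ (a₀ + (b₀ + c₀)) + (a₁ + (b₁ + c₁)) + (a₂ + (b₂ + c₂))
+-transpose₃ = solve-∀

-- The bound on the edges induced by a set meeting the layers of Q_{n+1}^3 in a, b, c vertices.
layeredBound : ℕ → ℕ → ℕ → ℕ
layeredBound a b c = digitSumsBelow a + (digitSumsBelow b + digitSumsBelow c) + (a ⊓ b + (a ⊓ c + b ⊓ c))

module _ (a b c : ℕ) where
  private
    F = digitSumsBelow
    P₀ = part₀ a + (part₀ b + part₀ c)
    P₁ = part₁ a + (part₁ b + part₁ c)
    P₂ = part₂ a + (part₂ b + part₂ c)

  layeredBound-parts : layeredBound a b c ≡
    layeredBound (part₀ a) (part₀ b) (part₀ c) + layeredBound (part₁ a) (part₁ b) (part₁ c)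
      + layeredBound (part₂ a) (part₂ b) (part₂ c) + (P₁ + 2 * P₂)
  layeredBound-parts = begin
    F a + (F b + F c) + (a ⊓ b + (a ⊓ c + b ⊓ c))
      ≡⟨ cong₂ _+_ (cong₂ _+_ (digitSumsBelow-parts a) (cong₂ _+_ (digitSumsBelow-parts b) (digitSumsBelow-parts c)))
                   (cong₂ _+_ (⊓-parts a b) (cong₂ _+_ (⊓-parts a c) (⊓-parts b c))) ⟩
    _ ≡⟨ cong₂ _+_ (trans (+-shuffle (Fparts a) (Fparts b) (Fparts c) (extra a) (extra b) (extra c))
                          (cong₂ _+_ (+-transpose₃ (F (part₀ a)) (F (part₁ a)) (F (part₂ a)) (F (part₀ b)) (F (part₁ b))
                                                   (F (part₂ b)) (F (part₀ c)) (F (part₁ c)) (F (part₂ c)))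
                                     (extras (part₁ a) (part₂ a) (part₁ b) (part₂ b) (part₁ c) (part₂ c))))
                   (+-transpose₃ (part₀ a ⊓ part₀ b) (part₁ a ⊓ part₁ b) (part₂ a ⊓ part₂ b)
                                 (part₀ a ⊓ part₀ c) (part₁ a ⊓ part₁ c) (part₂ a ⊓ part₂ c)
                                 (part₀ b ⊓ part₀ c) (part₁ b ⊓ part₁ c) (part₂ b ⊓ part₂ c)) ⟩
    _ ≡⟨ collect (Fs part₀) (Fs part₁) (Fs part₂) (P₁ + 2 * P₂) (Ms part₀) (Ms part₁) (Ms part₂) ⟩
    layeredBound (part₀ a) (part₀ b) (part₀ c) + layeredBound (part₁ a) (part₁ b) (part₁ c)
      + layeredBound (part₂ a) (part₂ b) (part₂ c) + (P₁ + 2 * P₂) ∎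
    where
    open ≡-Reasoning
    Fparts extra : ℕ → ℕ
    Fparts x = F (part₀ x) + F (part₁ x) + F (part₂ x)
    extra x = part₁ x + 2 * part₂ x
    Fs Ms : (ℕ → ℕ) → ℕ
    Fs p = F (p a) + (F (p b) + F (p c))
    Ms p = p a ⊓ p b + (p a ⊓ p c + p b ⊓ p c)
    extras : ∀ a₁ a₂ b₁ b₂ c₁ c₂ → (a₁ + 2 * a₂) + ((b₁ + 2 * b₂) + (c₁ + 2 * c₂)) ≡ (a₁ + (b₁ + c₁)) + 2 * (a₂ + (b₂ + c₂))
    extras = solve-∀
    collect : ∀ f₀ f₁ f₂ x m₀ m₁ m₂ → (f₀ + f₁ + f₂ + x) + (m₀ + m₁ + m₂) ≡ (f₀ + m₀) + (f₁ + m₁) + (f₂ + m₂) + x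
    collect = solve-∀

  -- (P₀, P₁, P₂) is a nearly balanced triple with the same sum as (a, b, c).
  digitSumsBelow-parts-merge : F P₀ + F P₁ + F P₂ + (P₁ + 2 * P₂) ≤ F (a + (b + c))
  digitSumsBelow-parts-merge = begin
    F P₀ + F P₁ + F P₂ + (P₁ + 2 * P₂)
      ≡⟨ cong₂ (λ u v → F u + F v + F P₂ + (v + 2 * P₂)) P₀≡ P₁≡ ⟩
    F (N₁ + P₂) + F (N₂ + P₂) + F P₂ + ((N₂ + P₂) + 2 * P₂)
      ≤⟨ digitSumsBelow-nearlyBalanced P₂ N₁ N₂ N₂≤N₁ N₁≤3 ⟩
    F ((N₁ + N₂) + triple P₂)
      ≡⟨ cong F total ⟨
    F (a + (b + c)) ∎
    where
    open ≤-Reasoning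
    module A = PartsShape (partsShape a)
    module B = PartsShape (partsShape b)
    module C = PartsShape (partsShape c)
    N₁ = A.excess₀ + (B.excess₀ + C.excess₀)
    N₂ = A.excess₁ + (B.excess₁ + C.excess₁)
    N₂≤N₁ : N₂ ≤ N₁
    N₂≤N₁ = +-mono-≤ A.excess₁≤excess₀ (+-mono-≤ B.excess₁≤excess₀ C.excess₁≤excess₀)
    N₁≤3 : N₁ ≤ 3
    N₁≤3 = +-mono-≤ A.excess₀≤1 (+-mono-≤ B.excess₀≤1 C.excess₀≤1)
    P₀≡ : P₀ ≡ N₁ + P₂
    P₀≡ = trans (cong₂ _+_ A.part₀≡ (cong₂ _+_ B.part₀≡ C.part₀≡)) (+-shuffle A.excess₀ B.excess₀ C.excess₀ (part₂ a) (part₂ b) (part₂ c))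
    P₁≡ : P₁ ≡ N₂ + P₂
    P₁≡ = trans (cong₂ _+_ A.part₁≡ (cong₂ _+_ B.part₁≡ C.part₁≡)) (+-shuffle A.excess₁ B.excess₁ C.excess₁ (part₂ a) (part₂ b) (part₂ c))
    regroup : ∀ a₀ a₁ b₀ b₁ c₀ c₁ p q r →
      (a₀ + a₁ + 3 * p) + ((b₀ + b₁ + 3 * q) + (c₀ + c₁ + 3 * r))
        ≡ (a₀ + (b₀ + c₀) + (a₁ + (b₁ + c₁))) + 3 * (p + (q + r))
    regroup = solve-∀
    total : a + (b + c) ≡ (N₁ + N₂) + triple P₂
    total = begin-equality
      a + (b + c)
        ≡⟨ cong₂ _+_ (partsShape-total a) (cong₂ _+_ (partsShape-total b) (partsShape-total c)) ⟩
      (A.excess₀ + A.excess₁ + 3 * part₂ a) + ((B.excess₀ + B.excess₁ + 3 * part₂ b)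
        + (C.excess₀ + C.excess₁ + 3 * part₂ c))
        ≡⟨ regroup A.excess₀ A.excess₁ B.excess₀ B.excess₁ C.excess₀ C.excess₁ (part₂ a) (part₂ b) (part₂ c) ⟩
      (N₁ + N₂) + 3 * P₂
        ≡⟨ cong (N₁ + N₂ +_) (triple≡3* P₂) ⟨
      (N₁ + N₂) + triple P₂ ∎

layeredBound-small : ∀ a b c → a ≤ 1 → b ≤ 1 → c ≤ 1 → layeredBound a b c ≤ digitSumsBelow (a + (b + c))
layeredBound-small 0 0 0 _ _ _ = ≤-refl
layeredBound-small 0 0 1 _ _ _ = ≤-refl
layeredBound-small 0 1 0 _ _ _ = ≤-refl
layeredBound-small 0 1 1 _ _ _ = ≤-refl
layeredBound-small 1 0 0 _ _ _ = ≤-refl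
layeredBound-small 1 0 1 _ _ _ = ≤-refl
layeredBound-small 1 1 0 _ _ _ = ≤-refl
layeredBound-small 1 1 1 _ _ _ = ≤-refl
layeredBound-small (suc (suc _)) _ _ (s≤s ()) _ _
layeredBound-small _ (suc (suc _)) _ _ (s≤s ()) _
layeredBound-small _ _ (suc (suc _)) _ _ (s≤s ())

small-or-parts< : ∀ a b c → (a ≤ 1 × b ≤ 1 × c ≤ 1) ⊎ (part₀ a + (part₀ b + part₀ c) < a + (b + c))
small-or-parts< a b c with 2 ≤? a | 2 ≤? b | 2 ≤? c
... | yes 2≤a | _ | _ = inj₂ (+-mono-<-≤ (part₀< a 2≤a) (+-mono-≤ (part₀≤ b) (part₀≤ c)))
... | no _ | yes 2≤b | _ = inj₂ (+-mono-≤-< (part₀≤ a) (+-mono-<-≤ (part₀< b 2≤b) (part₀≤ c)))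
... | no _ | no _ | yes 2≤c = inj₂ (+-mono-≤-< (part₀≤ a) (+-mono-≤-< (part₀≤ b) (part₀< c 2≤c)))
... | no 2≰a | no 2≰b | no 2≰c = inj₁ (≤-pred (≰⇒> 2≰a) , ≤-pred (≰⇒> 2≰b) , ≤-pred (≰⇒> 2≰c))

layeredBound≤digitSumsBelow : ∀ a b c → layeredBound a b c ≤ digitSumsBelow (a + (b + c))
layeredBound≤digitSumsBelow a b c = go a b c (<-wellFounded _)
  where
  Σpart₁≤Σpart₀ : ∀ a b c → part₁ a + (part₁ b + part₁ c) ≤ part₀ a + (part₀ b + part₀ c)
  Σpart₁≤Σpart₀ a b c = +-mono-≤ (proj₂ (parts-ordered a)) (+-mono-≤ (proj₂ (parts-ordered b)) (proj₂ (parts-ordered c)))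
  Σpart₂≤Σpart₁ : ∀ a b c → part₂ a + (part₂ b + part₂ c) ≤ part₁ a + (part₁ b + part₁ c)
  Σpart₂≤Σpart₁ a b c = +-mono-≤ (proj₁ (parts-ordered a)) (+-mono-≤ (proj₁ (parts-ordered b)) (proj₁ (parts-ordered c)))
  go : ∀ a b c → Acc _<_ (a + (b + c)) → layeredBound a b c ≤ digitSumsBelow (a + (b + c))
  go a b c (acc rec) with small-or-parts< a b c
  ... | inj₁ (a≤1 , b≤1 , c≤1) = layeredBound-small a b c a≤1 b≤1 c≤1
  ... | inj₂ Σpart₀< = begin
    layeredBound a b c
      ≡⟨ layeredBound-parts a b c ⟩
    layeredBound (part₀ a) (part₀ b) (part₀ c) + layeredBound (part₁ a) (part₁ b) (part₁ c)
      + layeredBound (part₂ a) (part₂ b) (part₂ c) + _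
      ≤⟨ +-monoˡ-≤ _ (+-mono-≤ (+-mono-≤ (go (part₀ a) (part₀ b) (part₀ c) (rec Σpart₀<))
                                          (go (part₁ a) (part₁ b) (part₁ c) (rec Σpart₁<)))
                                          (go (part₂ a) (part₂ b) (part₂ c) (rec Σpart₂<))) ⟩
    _ ≤⟨ digitSumsBelow-parts-merge a b c ⟩
    digitSumsBelow (a + (b + c)) ∎
    where
    open ≤-Reasoning
    Σpart₁< = ≤-<-trans (Σpart₁≤Σpart₀ a b c) Σpart₀<
    Σpart₂< = ≤-<-trans (Σpart₂≤Σpart₁ a b c) Σpart₁<

-- Sums over the vertices and edges of Q_n^3

private
  variable
    A B : Set

sum-map-0 : ∀ (xs : List A) → sum (map (λ _ → 0) xs) ≡ 0
sum-map-0 []       = refl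
sum-map-0 (_ ∷ xs) = sum-map-0 xs

sum-map-++ : ∀ (f : A → ℕ) xs ys → sum (map f (xs ++ ys)) ≡ sum (map f xs) + sum (map f ys)
sum-map-++ f xs ys = trans (cong sum (map-++ f xs ys)) (sum-++ (map f xs) (map f ys))

sum-map-cong : ∀ {f g : A → ℕ} → (∀ x → f x ≡ g x) → ∀ xs → sum (map f xs) ≡ sum (map g xs)
sum-map-cong f≗g xs = cong sum (map-cong f≗g xs)

sum-map-congᴬ : ∀ {f g : A → ℕ} {xs} → All (λ x → f x ≡ g x) xs → sum (map f xs) ≡ sum (map g xs)
sum-map-congᴬ All.[]                = refl
sum-map-congᴬ (fx≡gx All.∷ fxs≡gxs) = cong₂ _+_ fx≡gx (sum-map-congᴬ fxs≡gxs)

sum-map-+ : ∀ (f g : A → ℕ) xs → sum (map (λ x → f x + g x) xs) ≡ sum (map f xs) + sum (map g xs)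
sum-map-+ f g []       = refl
sum-map-+ f g (x ∷ xs) = trans (cong (f x + g x +_) (sum-map-+ f g xs)) (interchange (f x) (g x) _ _)

sum-map-* : ∀ c (f : A → ℕ) xs → sum (map (λ x → c * f x) xs) ≡ c * sum (map f xs)
sum-map-* c f []       = sym (*-zeroʳ c)
sum-map-* c f (x ∷ xs) = trans (cong (c * f x +_) (sum-map-* c f xs)) (sym (*-distribˡ-+ c (f x) _))

sum-map-mono : ∀ {f g : A → ℕ} → (∀ x → f x ≤ g x) → ∀ xs → sum (map f xs) ≤ sum (map g xs)
sum-map-mono f≤g []       = z≤n
sum-map-mono f≤g (x ∷ xs) = +-mono-≤ (f≤g x) (sum-map-mono f≤g xs)

sum-map-map : ∀ (f : B → ℕ) (g : A → B) xs → sum (map f (map g xs)) ≡ sum (map (f ∘ g) xs)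
sum-map-map f g xs = cong sum (sym (map-∘ xs))

sum-map-swap : ∀ (f : A → B → ℕ) xs ys →
  sum (map (λ x → sum (map (f x) ys)) xs) ≡ sum (map (λ y → sum (map (λ x → f x y) xs)) ys)
sum-map-swap f []       ys = sym (sum-map-0 ys)
sum-map-swap f (x ∷ xs) ys =
  trans (cong (sum (map (f x) ys) +_) (sum-map-swap f xs ys)) (sym (sum-map-+ (f x) _ ys))

sum-map-filter : ∀ (p : A → Bool) (g : A → ℕ) xs →
  sum (map g (filter (λ x → p x Bool.≟ true) xs)) ≡ sum (map (λ x → if p x then g x else 0) xs)
sum-map-filter p g [] = refl
sum-map-filter p g (x ∷ xs) with p x
... | true  = cong (g x +_) (sum-map-filter p g xs)
... | false = sum-map-filter p g xs

sumFin3 : (Fin 3 → ℕ) → ℕ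
sumFin3 f = f zero + (f (suc zero) + f (suc (suc zero)))

sumVertices : (n : ℕ) → (Vertex n → ℕ) → ℕ
sumVertices n h = sum (map h (allVertices n))

sumVertices-suc : ∀ n (h : Vertex (suc n) → ℕ) → sumVertices (suc n) h ≡ sumFin3 (λ x → sumVertices n (h ∘ (x ∷_)))
sumVertices-suc n h = begin
  sum (map h (V₀ ++ (V₁ ++ (V₂ ++ []))))
    ≡⟨ trans (sum-map-++ h V₀ _) (cong (sum (map h V₀) +_) (trans (sum-map-++ h V₁ _) (cong (sum (map h V₁) +_)
         (trans (sum-map-++ h V₂ []) (+-identityʳ _))))) ⟩
  sum (map h V₀) + (sum (map h V₁) + sum (map h V₂))
    ≡⟨ cong₂ _+_ (sum-map-map h _ L) (cong₂ _+_ (sum-map-map h _ L) (sum-map-map h _ L)) ⟩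
  sumFin3 (λ x → sumVertices n (h ∘ (x ∷_))) ∎
  where
  open ≡-Reasoning
  L = allVertices n
  V₀ = map (zero ∷_) L
  V₁ = map (suc zero ∷_) L
  V₂ = map (suc (suc zero) ∷_) L

-- Use `does`, not ⌊_⌋: `does ((x ∷ u) ≟ⱽ (y ∷ v))` computes to `does (x ≟ y) ∧ does (u ≟ⱽ v)`.
infix 4 _≟ⱽ_
_≟ⱽ_ : ∀ {n} → DecidableEquality (Vertex n)
_≟ⱽ_ = ≡-dec Fin._≟_

sumVertices-δ : ∀ n (u : Vertex n) (h : Vertex n → ℕ) → sumVertices n (λ v → if does (u ≟ⱽ v) then h v else 0) ≡ h u
sumVertices-δ zero [] h = +-identityʳ (h [])
sumVertices-δ (suc n) (x ∷ u) h = trans (sumVertices-suc n _) (layers x)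
  where
  off : sumVertices n (λ _ → 0) ≡ 0
  off = sum-map-0 (allVertices n)
  on : ∀ y → sumVertices n (λ v → if does (u ≟ⱽ v) then h (y ∷ v) else 0) ≡ h (y ∷ u)
  on y = sumVertices-δ n u (h ∘ (y ∷_))
  layers : ∀ x → sumFin3 (λ y → sumVertices n (λ v → if does ((x ∷ u) ≟ⱽ (y ∷ v)) then h (y ∷ v) else 0)) ≡ h (x ∷ u)
  layers zero = trans (cong₂ _+_ (on zero) (cong₂ _+_ off off)) (+-identityʳ _)
  layers (suc zero) = trans (cong₂ _+_ off (cong₂ _+_ (on _) off)) (+-identityʳ _)
  layers (suc (suc zero)) = cong₂ _+_ off (cong₂ _+_ off (on _))

module _ {n} {σ : Vertex n → Vertex n} (σ-injective : Injective _≡_ _≡_ σ)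
         (σ-surjective : StrictlySurjective _≡_ σ) where

  private
    preimage-count : ∀ (h : Vertex n → ℕ) w → sumVertices n (λ v → if does (σ v ≟ⱽ w) then h w else 0) ≡ h w
    preimage-count h w with σ-surjective w
    ... | u , refl = trans (sum-map-cong same-test (allVertices n)) (sumVertices-δ n u (λ _ → h (σ u)))
      where
      same-test : ∀ v → (if does (σ v ≟ⱽ σ u) then h (σ u) else 0) ≡ (if does (u ≟ⱽ v) then h (σ u) else 0)
      same-test v with σ v ≟ⱽ σ u | u ≟ⱽ v
      ... | yes _   | yes _ = refl
      ... | no _    | no _  = refl
      ... | yes σv≡σu | no u≢v = contradiction (sym (σ-injective σv≡σu)) u≢v
      ... | no σv≢σu | yes refl = contradiction refl σv≢σu

  sumVertices-permute : ∀ h → sumVertices n (h ∘ σ) ≡ sumVertices n h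
  sumVertices-permute h = begin
    sumVertices n (h ∘ σ)
      ≡⟨ sum-map-cong (λ v → sumVertices-δ n (σ v) h) (allVertices n) ⟨
    sumVertices n (λ v → sumVertices n (λ w → if does (σ v ≟ⱽ w) then h w else 0))
      ≡⟨ sum-map-swap (λ v w → if does (σ v ≟ⱽ w) then h w else 0) (allVertices n) (allVertices n) ⟩
    sumVertices n (λ w → sumVertices n (λ v → if does (σ v ≟ⱽ w) then h w else 0))
      ≡⟨ sum-map-cong (preimage-count h) (allVertices n) ⟩
    sumVertices n h ∎
    where open ≡-Reasoning

sumVertices-bijection : ∀ {n} {B : Set} (f g : Vertex n ⤖ B) (h : B → ℕ) →
  sumVertices n (h ∘ Bijection.to f) ≡ sumVertices n (h ∘ Bijection.to g)
sumVertices-bijection {n} f g h = begin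
  sumVertices n (h ∘ F.to)          ≡⟨ sum-map-cong (λ v → cong h (sym (g∘σ≡f v))) (allVertices n) ⟩
  sumVertices n (h ∘ G.to ∘ σ)      ≡⟨ sumVertices-permute σ-injective σ-surjective (h ∘ G.to) ⟩
  sumVertices n (h ∘ G.to)          ∎
  where
  open ≡-Reasoning
  module F = Bijection f
  module G = Bijection g
  σ : Vertex n → Vertex n
  σ v = proj₁ (G.strictlySurjective (F.to v))
  g∘σ≡f : ∀ v → G.to (σ v) ≡ F.to v
  g∘σ≡f v = proj₂ (G.strictlySurjective (F.to v))
  σ-injective : Injective _≡_ _≡_ σ
  σ-injective {u} {v} σu≡σv = F.injective (trans (sym (g∘σ≡f u)) (trans (cong G.to σu≡σv) (g∘σ≡f v)))
  σ-surjective : StrictlySurjective _≡_ σ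
  σ-surjective w with F.strictlySurjective (G.to w)
  ... | u , fu≡gw = u , G.injective (trans (g∘σ≡f u) fu≡gw)

edgeSum : (n : ℕ) → (Vertex n → Vertex n → ℕ) → ℕ
edgeSum n w = sum (map (λ e → w (proj₁ e) (proj₂ e)) (edgesQ n))

module _ (n : ℕ) where

  edgeSum-+ : ∀ (w w′ : Vertex n → Vertex n → ℕ) → edgeSum n (λ u v → w u v + w′ u v) ≡ edgeSum n w + edgeSum n w′
  edgeSum-+ w w′ = sum-map-+ _ _ (edgesQ n)

  edgeSum-* : ∀ c (w : Vertex n → Vertex n → ℕ) → edgeSum n (λ u v → c * w u v) ≡ c * edgeSum n w
  edgeSum-* c w = sum-map-* c _ (edgesQ n)

  edgeSum-sumBelow : ∀ T (w : ℕ → Vertex n → Vertex n → ℕ) →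
    edgeSum n (λ u v → sumBelow T (λ t → w t u v)) ≡ sumBelow T (λ t → edgeSum n (w t))
  edgeSum-sumBelow zero    w = sum-map-0 (edgesQ n)
  edgeSum-sumBelow (suc T) w =
    trans (edgeSum-+ (λ u v → sumBelow T (λ t → w t u v)) (w T)) (cong (_+ edgeSum n (w T)) (edgeSum-sumBelow T w))

numDiff-refl : ∀ {n} (u : Vertex n) → numDiff u u ≡ 0
numDiff-refl []                    = refl
numDiff-refl (zero ∷ u)            = numDiff-refl u
numDiff-refl (suc zero ∷ u)        = numDiff-refl u
numDiff-refl (suc (suc zero) ∷ u)  = numDiff-refl u

adjQ⇒≢ : ∀ {n} {u v : Vertex n} → adjQ u v ≡ true → u ≢ v
adjQ⇒≢ {u = u} adj refl with () ← trans (sym adj) (cong (λ d → isOne d ∧ diffsPM1 u u) (numDiff-refl u))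

edgeSum-cong : ∀ n {w w′ : Vertex n → Vertex n → ℕ} → (∀ u v → u ≢ v → w u v ≡ w′ u v) → edgeSum n w ≡ edgeSum n w′
edgeSum-cong n w≗w′ = sum-map-congᴬ
  (All.map (λ {e} adj → w≗w′ (proj₁ e) (proj₂ e) (adjQ⇒≢ adj))
           (all-filter (λ e → adjQ (proj₁ e) (proj₂ e) Bool.≟ true) (pairs (allVertices n))))

-- Across two distinct layers the head coordinates always differ by ±1 (mod 3),
-- so adjacency reduces to equality of the tails.
adjQ-across : ∀ {n} (u v : Vertex n) → isOne (suc (numDiff u v)) ∧ diffsPM1 u v ≡ does (u ≟ⱽ v)
adjQ-across [] [] = refl
adjQ-across (zero ∷ u)           (zero ∷ v)           = adjQ-across u v
adjQ-across (zero ∷ u)           (suc zero ∷ v)       = refl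
adjQ-across (zero ∷ u)           (suc (suc zero) ∷ v) = refl
adjQ-across (suc zero ∷ u)       (zero ∷ v)           = refl
adjQ-across (suc zero ∷ u)       (suc zero ∷ v)       = adjQ-across u v
adjQ-across (suc zero ∷ u)       (suc (suc zero) ∷ v) = refl
adjQ-across (suc (suc zero) ∷ u) (zero ∷ v)           = refl
adjQ-across (suc (suc zero) ∷ u) (suc zero ∷ v)       = refl
adjQ-across (suc (suc zero) ∷ u) (suc (suc zero) ∷ v) = adjQ-across u v

private
  pairSum : (A → A → ℕ) → List A → ℕ
  pairSum V xs = sum (map (λ e → V (proj₁ e) (proj₂ e)) (pairs xs))

  crossSum : (A → A → ℕ) → List A → List A → ℕ
  crossSum V xs ys = sum (map (λ x → sum (map (V x) ys)) xs)

  pairSum-∷ : ∀ (V : A → A → ℕ) x xs → pairSum V (x ∷ xs) ≡ sum (map (V x) xs) + pairSum V xs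
  pairSum-∷ V x xs = trans (sum-map-++ _ (map (x ,_) xs) (pairs xs)) (cong (_+ pairSum V xs) (sum-map-map _ (x ,_) xs))

  pairSum-++ : ∀ (V : A → A → ℕ) xs ys → pairSum V (xs ++ ys) ≡ pairSum V xs + crossSum V xs ys + pairSum V ys
  pairSum-++ V []       ys = refl
  pairSum-++ V (x ∷ xs) ys = begin
    pairSum V (x ∷ (xs ++ ys))
      ≡⟨ pairSum-∷ V x (xs ++ ys) ⟩
    sum (map (V x) (xs ++ ys)) + pairSum V (xs ++ ys)
      ≡⟨ cong₂ _+_ (sum-map-++ (V x) xs ys) (pairSum-++ V xs ys) ⟩
    (sum (map (V x) xs) + sum (map (V x) ys)) + (pairSum V xs + crossSum V xs ys + pairSum V ys)
      ≡⟨ regroup (sum (map (V x) xs)) (sum (map (V x) ys)) (pairSum V xs) (crossSum V xs ys) (pairSum V ys) ⟩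
    (sum (map (V x) xs) + pairSum V xs) + crossSum V (x ∷ xs) ys + pairSum V ys
      ≡⟨ cong (λ p → p + crossSum V (x ∷ xs) ys + pairSum V ys) (pairSum-∷ V x xs) ⟨
    pairSum V (x ∷ xs) + crossSum V (x ∷ xs) ys + pairSum V ys ∎
    where
    open ≡-Reasoning
    regroup : ∀ a b p c q → (a + b) + (p + c + q) ≡ (a + p) + (b + c) + q
    regroup = solve-∀

  crossSum-++ : ∀ (V : A → A → ℕ) xs ys zs → crossSum V xs (ys ++ zs) ≡ crossSum V xs ys + crossSum V xs zs
  crossSum-++ V xs ys zs = trans (sum-map-cong (λ x → sum-map-++ (V x) ys zs) xs) (sum-map-+ _ _ xs)

  pairSum-++₃ : ∀ (V : A → A → ℕ) xs ys zs → pairSum V (xs ++ (ys ++ (zs ++ []))) ≡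
    (pairSum V xs + (pairSum V ys + pairSum V zs)) + (crossSum V xs ys + (crossSum V xs zs + crossSum V ys zs))
  pairSum-++₃ V xs ys zs
    rewrite pairSum-++ V xs (ys ++ (zs ++ [])) | pairSum-++ V ys (zs ++ []) | pairSum-++ V zs []
          | crossSum-++ V xs ys (zs ++ []) | crossSum-++ V xs zs [] | crossSum-++ V ys zs []
          | sum-map-0 xs | sum-map-0 ys | sum-map-0 zs
    = regroup (pairSum V xs) (pairSum V ys) (pairSum V zs) (crossSum V xs ys) (crossSum V xs zs) (crossSum V ys zs)
    where
    regroup : ∀ p q r a b c → p + (a + (b + 0)) + (q + (c + 0) + (r + 0 + 0)) ≡ (p + (q + r)) + (a + (b + c))
    regroup = solve-∀

  pairSum-map : ∀ (V : B → B → ℕ) (f : A → B) xs → pairSum V (map f xs) ≡ pairSum (λ a b → V (f a) (f b)) xs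
  pairSum-map V f []       = refl
  pairSum-map V f (x ∷ xs) =
    trans (pairSum-∷ V (f x) (map f xs))
          (trans (cong₂ _+_ (sum-map-map (V (f x)) f xs) (pairSum-map V f xs))
                 (sym (pairSum-∷ (λ a b → V (f a) (f b)) x xs)))

  crossSum-map : ∀ (V : B → B → ℕ) (f g : A → B) xs ys →
    crossSum V (map f xs) (map g ys) ≡ sum (map (λ a → sum (map (λ b → V (f a) (g b)) ys)) xs)
  crossSum-map V f g xs ys = trans (sum-map-map _ f xs) (sum-map-cong (λ a → sum-map-map (V (f a)) g ys) xs)

within : ∀ n → (Vertex (suc n) → Vertex (suc n) → ℕ) → Fin 3 → ℕ
within n w x = edgeSum n (λ u v → w (x ∷ u) (x ∷ v))

between : ∀ n → (Vertex (suc n) → Vertex (suc n) → ℕ) → Fin 3 → Fin 3 → ℕ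
between n w x y = sumVertices n (λ u → w (x ∷ u) (y ∷ u))

edgeSum-suc : ∀ n (w : Vertex (suc n) → Vertex (suc n) → ℕ) → edgeSum (suc n) w ≡
  sumFin3 (within n w) + (between n w zero (suc zero) + (between n w zero (suc (suc zero)) + between n w (suc zero) (suc (suc zero))))
edgeSum-suc n w = begin
  edgeSum (suc n) w
    ≡⟨ edgeSum≡pairSum (suc n) w ⟩
  pairSum (adjacentOnly w) (V zero ++ (V (suc zero) ++ (V (suc (suc zero)) ++ [])))
    ≡⟨ pairSum-++₃ (adjacentOnly w) (V zero) (V (suc zero)) (V (suc (suc zero))) ⟩
  _ ≡⟨ cong₂ _+_ (cong₂ _+_ (layer zero) (cong₂ _+_ (layer (suc zero)) (layer (suc (suc zero)))))
                 (cong₂ _+_ (rung zero (suc zero) adjQ-across)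
                    (cong₂ _+_ (rung zero (suc (suc zero)) adjQ-across) (rung (suc zero) (suc (suc zero)) adjQ-across))) ⟩
  _ ∎
  where
  open ≡-Reasoning
  L = allVertices n
  V : Fin 3 → List (Vertex (suc n))
  V x = map (x ∷_) L
  adjacentOnly : ∀ {m} → (Vertex m → Vertex m → ℕ) → Vertex m → Vertex m → ℕ
  adjacentOnly w u v = if adjQ u v then w u v else 0
  edgeSum≡pairSum : ∀ m (w : Vertex m → Vertex m → ℕ) → edgeSum m w ≡ pairSum (adjacentOnly w) (allVertices m)
  edgeSum≡pairSum m w = sum-map-filter (λ e → adjQ (proj₁ e) (proj₂ e)) _ (pairs (allVertices m))
  layer : ∀ x → pairSum (adjacentOnly w) (V x) ≡ within n w x
  layer zero             = trans (pairSum-map (adjacentOnly w) _ L) (sym (edgeSum≡pairSum n _))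
  layer (suc zero)       = trans (pairSum-map (adjacentOnly w) _ L) (sym (edgeSum≡pairSum n _))
  layer (suc (suc zero)) = trans (pairSum-map (adjacentOnly w) _ L) (sym (edgeSum≡pairSum n _))
  rung : ∀ x y → (∀ u v → adjQ (x ∷ u) (y ∷ v) ≡ does (u ≟ⱽ v)) →
         crossSum (adjacentOnly w) (V x) (V y) ≡ between n w x y
  rung x y across = trans (crossSum-map (adjacentOnly w) _ _ L L) (sum-map-cong (λ u →
    trans (sum-map-cong (λ v → cong (λ b → if b then w (x ∷ u) (y ∷ v) else 0) (across u v)) L)
          (sumVertices-δ n u (λ v → w (x ∷ u) (y ∷ v)))) L)

-- Q_n^3 is 2n-regular.
edgeSum-handshake : ∀ n (h : Vertex n → ℕ) → edgeSum n (λ u v → h u + h v) ≡ n * (2 * sumVertices n h)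
edgeSum-handshake zero    h = refl
edgeSum-handshake (suc n) h = begin
  edgeSum (suc n) (λ u v → h u + h v)
    ≡⟨ edgeSum-suc n (λ u v → h u + h v) ⟩
  _ ≡⟨ cong₂ _+_ (cong₂ _+_ (edgeSum-handshake n (H zero))
                    (cong₂ _+_ (edgeSum-handshake n (H (suc zero))) (edgeSum-handshake n (H (suc (suc zero))))))
                 (cong₂ _+_ (sum-map-+ (H zero) (H (suc zero)) L)
                    (cong₂ _+_ (sum-map-+ (H zero) (H (suc (suc zero))) L) (sum-map-+ (H (suc zero)) (H (suc (suc zero))) L))) ⟩
  _ ≡⟨ regroup n (Σ (H zero)) (Σ (H (suc zero))) (Σ (H (suc (suc zero)))) ⟩
  suc n * (2 * sumFin3 (λ x → Σ (H x)))
    ≡⟨ cong (λ s → suc n * (2 * s)) (sumVertices-suc n h) ⟨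
  suc n * (2 * sumVertices (suc n) h) ∎
  where
  open ≡-Reasoning
  L = allVertices n
  Σ = sumVertices n
  H : Fin 3 → Vertex n → ℕ
  H x v = h (x ∷ v)
  regroup : ∀ n a b c → n * (2 * a) + (n * (2 * b) + n * (2 * c)) + ((a + b) + ((a + c) + (b + c)))
                        ≡ suc n * (2 * (a + (b + c)))
  regroup = solve-∀

-- Lindsey's theorem and lexicographic initial segments

indicator : Bool → ℕ
indicator true  = 1
indicator false = 0

indicator-∧ˡ : ∀ a b → indicator (a ∧ b) ≤ indicator a
indicator-∧ˡ true  true  = ≤-refl
indicator-∧ˡ true  false = z≤n
indicator-∧ˡ false _     = z≤n

indicator-∧ʳ : ∀ a b → indicator (a ∧ b) ≤ indicator b
indicator-∧ʳ true  _ = ≤-refl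
indicator-∧ʳ false _ = z≤n

size : ∀ n → (Vertex n → Bool) → ℕ
size n S = sumVertices n (indicator ∘ S)

inducedEdges : ∀ n → (Vertex n → Bool) → ℕ
inducedEdges n S = edgeSum n (λ u v → indicator (S u ∧ S v))

inducedEdges≤digitSumsBelow : ∀ n (S : Vertex n → Bool) → inducedEdges n S ≤ digitSumsBelow (size n S)
inducedEdges≤digitSumsBelow zero    S = z≤n
inducedEdges≤digitSumsBelow (suc n) S = begin
  inducedEdges (suc n) S
    ≡⟨ edgeSum-suc n _ ⟩
  sumFin3 (within n W) + (between n W zero (suc zero) + (between n W zero (suc (suc zero)) + between n W (suc zero) (suc (suc zero))))
    ≤⟨ +-mono-≤ (+-mono-≤ (inside zero) (+-mono-≤ (inside (suc zero)) (inside (suc (suc zero)))))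
                 (+-mono-≤ (across zero (suc zero)) (+-mono-≤ (across zero (suc (suc zero))) (across (suc zero) (suc (suc zero))))) ⟩
  layeredBound (a zero) (a (suc zero)) (a (suc (suc zero)))
    ≤⟨ layeredBound≤digitSumsBelow (a zero) (a (suc zero)) (a (suc (suc zero))) ⟩
  digitSumsBelow (sumFin3 a)
    ≡⟨ cong digitSumsBelow (sumVertices-suc n (indicator ∘ S)) ⟨
  digitSumsBelow (size (suc n) S) ∎
  where
  open ≤-Reasoning
  W : Vertex (suc n) → Vertex (suc n) → ℕ
  W u v = indicator (S u ∧ S v)
  layer : Fin 3 → Vertex n → Bool
  layer x v = S (x ∷ v)
  a : Fin 3 → ℕ
  a x = size n (layer x)
  inside : ∀ x → within n W x ≤ digitSumsBelow (a x)
  inside x = inducedEdges≤digitSumsBelow n (layer x)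
  across : ∀ x y → between n W x y ≤ a x ⊓ a y
  across x y = ⊓-glb (sum-map-mono (λ u → indicator-∧ˡ (layer x u) (layer y u)) (allVertices n))
                     (sum-map-mono (λ u → indicator-∧ʳ (layer x u) (layer y u)) (allVertices n))

size-cong : ∀ n {S S′ : Vertex n → Bool} → (∀ v → S v ≡ S′ v) → size n S ≡ size n S′
size-cong n S≗S′ = sum-map-cong (cong indicator ∘ S≗S′) (allVertices n)

inducedEdges-cong : ∀ n {S S′ : Vertex n → Bool} → (∀ v → S v ≡ S′ v) → inducedEdges n S ≡ inducedEdges n S′
inducedEdges-cong n S≗S′ = sum-map-cong (λ e → cong indicator (cong₂ _∧_ (S≗S′ (proj₁ e)) (S≗S′ (proj₂ e)))) (edgesQ n)

digitSum-+triple : ∀ e m → e < 3 → digitSum (e + triple m) ≡ e + digitSum m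
digitSum-+triple 0 m _ = digitSum-triple m
digitSum-+triple 1 m _ = digitSum-triple+1 m
digitSum-+triple 2 m _ = digitSum-triple+2 m
digitSum-+triple (suc (suc (suc _))) m (s≤s (s≤s (s≤s ())))

-- The base-3 digits of d * 3^N + j (j < 3^N) are those of j followed by those of d.
digitSum-shift : ∀ N d j → j < 3 ^ N → digitSum (d * 3 ^ N + j) ≡ digitSum d + digitSum j
digitSum-shift zero d zero _ = trans (cong digitSum (trans (+-identityʳ _) (*-identityʳ d))) (sym (+-identityʳ _))
digitSum-shift zero d (suc j) (s≤s ())
digitSum-shift (suc N) d j = split (residue3 j)
  where
  M = 3 ^ N
  shifted : ∀ e j′ → e < 3 → e + triple j′ < 3 ^ suc N →
            digitSum (d * 3 ^ suc N + (e + triple j′)) ≡ digitSum d + digitSum (e + triple j′)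
  shifted e j′ e<3 lt = begin
    digitSum (d * 3 ^ suc N + (e + triple j′))   ≡⟨ cong digitSum regroup ⟩
    digitSum (e + triple (d * M + j′))            ≡⟨ digitSum-+triple e _ e<3 ⟩
    e + digitSum (d * M + j′)                     ≡⟨ cong (e +_) (digitSum-shift N d j′ j′<M) ⟩
    e + (digitSum d + digitSum j′)                ≡⟨ x∙yz≈y∙xz e (digitSum d) (digitSum j′) ⟩
    digitSum d + (e + digitSum j′)                ≡⟨ cong (digitSum d +_) (digitSum-+triple e j′ e<3) ⟨
    digitSum d + digitSum (e + triple j′)         ∎
    where
    open ≡-Reasoning
    regroup : d * 3 ^ suc N + (e + triple j′) ≡ e + triple (d * M + j′)
    regroup rewrite triple≡3* j′ | triple≡3* (d * M + j′) = e′ d M e j′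
      where
      e′ : ∀ d M e j → d * (3 * M) + (e + 3 * j) ≡ e + 3 * (d * M + j)
      e′ = solve-∀
    j′<M : j′ < M
    j′<M = *-cancelˡ-< 3 j′ M (subst (_< 3 * M) (triple≡3* j′) (≤-<-trans (m≤n+m (triple j′) e) lt))
  split : ∀ {j} → Residue3 j → j < 3 ^ suc N → digitSum (d * 3 ^ suc N + j) ≡ digitSum d + digitSum j
  split (3* j′ +0) = shifted 0 j′ (s≤s z≤n)
  split (3* j′ +1) = shifted 1 j′ (s≤s (s≤s z≤n))
  split (3* j′ +2) = shifted 2 j′ ≤-refl

digitSumsBelow-shift : ∀ N d r → r ≤ 3 ^ N →
  digitSumsBelow (d * 3 ^ N + r) ≡ digitSumsBelow (d * 3 ^ N) + digitSum d * r + digitSumsBelow r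
digitSumsBelow-shift N d zero _ =
  trans (cong digitSumsBelow (+-identityʳ (d * 3 ^ N)))
        (sym (trans (+-identityʳ _) (trans (cong (digitSumsBelow (d * 3 ^ N) +_) (*-zeroʳ (digitSum d))) (+-identityʳ _))))
digitSumsBelow-shift N d (suc r) r< = begin
  digitSumsBelow (d * 3 ^ N + suc r)
    ≡⟨ cong digitSumsBelow (+-suc (d * 3 ^ N) r) ⟩
  digitSumsBelow (d * 3 ^ N + r) + digitSum (d * 3 ^ N + r)
    ≡⟨ cong₂ _+_ (digitSumsBelow-shift N d r (<⇒≤ r<)) (digitSum-shift N d r r<) ⟩
  digitSumsBelow (d * 3 ^ N) + digitSum d * r + digitSumsBelow r + (digitSum d + digitSum r)
    ≡⟨ regroup (digitSumsBelow (d * 3 ^ N)) (digitSum d) r (digitSumsBelow r) (digitSum r) ⟩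
  digitSumsBelow (d * 3 ^ N) + digitSum d * suc r + (digitSumsBelow r + digitSum r) ∎
  where
  open ≡-Reasoning
  regroup : ∀ a s r f t → a + s * r + f + (s + t) ≡ a + s * suc r + (f + t)
  regroup = solve-∀

value : ∀ {n} → Vertex n → ℕ
value v = toℕ (toFin3 v)

layerOffset : Fin 3 → ℕ → ℕ
layerOffset zero             M = 0
layerOffset (suc zero)       M = M
layerOffset (suc (suc zero)) M = M + M

value-∷ : ∀ {n} x (v : Vertex n) → value (x ∷ v) ≡ layerOffset x (3 ^ n) + value v
value-∷ {n} x v = trans (toℕ-combine x (toFin3 v)) (cong (_+ value v) (offset x))
  where
  offset : ∀ x → 3 ^ n * toℕ x ≡ layerOffset x (3 ^ n)
  offset zero             = *-zeroʳ (3 ^ n)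
  offset (suc zero)       = *-identityʳ (3 ^ n)
  offset (suc (suc zero)) = trans (*-comm (3 ^ n) 2) (cong (3 ^ n +_) (+-identityʳ (3 ^ n)))

initialSegment : ∀ {n} → ℕ → Vertex n → Bool
initialSegment s v = does (value v <? s)

initialSegment-∷ : ∀ {n} s x (w : Vertex n) → initialSegment s (x ∷ w) ≡ initialSegment (s ∸ layerOffset x (3 ^ n)) w
initialSegment-∷ {n} s x w =
  trans (cong (λ k → does (k <? s)) (value-∷ x w)) (does-⇔ (mk⇔ +<⇒<∸ <∸⇒+<) (_ <? s) (value w <? _))
  where
  a = layerOffset x (3 ^ n)
  +<⇒<∸ : a + value w < s → value w < s ∸ a
  +<⇒<∸ lt = m+n≤o⇒m≤o∸n (suc (value w)) (subst (_≤ s) (cong suc (+-comm a (value w))) lt)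
  <∸⇒+< : value w < s ∸ a → a + value w < s
  <∸⇒+< lt = subst (_≤ s) (cong suc (+-comm (value w) a))
                   (m≤o∸n⇒m+n≤o (suc (value w)) (<⇒≤ (m∸n≢0⇒n<m (m<n⇒n≢0 lt))) lt)

initialSegment-full : ∀ {n} {s} (w : Vertex n) → 3 ^ n ≤ s → initialSegment s w ≡ true
initialSegment-full w 3ⁿ≤s = dec-true (value w <? _) (<-≤-trans (toℕ<n (toFin3 w)) 3ⁿ≤s)

initialSegment-∧ : ∀ {n} {a b} (w : Vertex n) → b ≤ a → initialSegment a w ∧ initialSegment b w ≡ initialSegment b w
initialSegment-∧ {a = a} {b} w b≤a with value w <? b
... | yes v<b = trans (cong₂ _∧_ (dec-true (value w <? a) (<-≤-trans v<b b≤a)) b?≡true) (sym b?≡true)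
  where b?≡true = dec-true (value w <? b) v<b
... | no v≮b  = trans (cong (does (value w <? a) ∧_) b?≡false) (trans (∧-zeroʳ (does (value w <? a))) (sym b?≡false))
  where b?≡false = dec-false (value w <? b) v≮b

-- The initial segment of size s of Q_{N+1}^3 meets the layer x ∷ Q_N^3 in an initial segment,
-- of size s₀, s₁, s₂ for x = 0, 1, 2.
record SegmentLayers (N s : ℕ) : Set where
  field
    s₀ s₁ s₂ : ℕ
    s₂≤s₁    : s₂ ≤ s₁
    s₁≤s₀    : s₁ ≤ s₀
    s₀≤3^N   : s₀ ≤ 3 ^ N
    layer    : ∀ x (w : Vertex N) → initialSegment s (x ∷ w) ≡ initialSegment (triad s₀ s₁ s₂ (toℕ x)) w
    sizes    : s₀ + (s₁ + s₂) ≡ s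
    digitSumsBelow-≤ : digitSumsBelow s ≤
                       digitSumsBelow s₀ + (digitSumsBelow s₁ + digitSumsBelow s₂) + (s₁ + (s₂ + s₂))

module _ (N : ℕ) where
  private
    M = 3 ^ N
    F = digitSumsBelow

    offsetTo : ∀ s {t} x (w : Vertex N) → s ∸ layerOffset x M ≡ t → initialSegment s (x ∷ w) ≡ initialSegment t w
    offsetTo s x w eq = trans (initialSegment-∷ s x w) (cong (λ t → initialSegment t w) eq)

    full : ∀ {t} (w : Vertex N) → M ≤ t → initialSegment t w ≡ initialSegment M w
    full w M≤t = trans (initialSegment-full w M≤t) (sym (initialSegment-full w ≤-refl))

    digitSumsBelow-M+ : ∀ r → r ≤ M → F (M + r) ≡ F M + r + F r
    digitSumsBelow-M+ r r≤M = begin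
      F (M + r)                 ≡⟨ cong (λ K → F (K + r)) (*-identityˡ M) ⟨
      F (1 * M + r)             ≡⟨ digitSumsBelow-shift N 1 r r≤M ⟩
      F (1 * M) + 1 * r + F r   ≡⟨ cong₂ (λ K z → F K + z + F r) (*-identityˡ M) (*-identityˡ r) ⟩
      F M + r + F r             ∎
      where open ≡-Reasoning

    digitSumsBelow-M+M+ : ∀ r → r ≤ M → F (M + (M + r)) ≡ F M + M + F M + 2 * r + F r
    digitSumsBelow-M+M+ r r≤M = begin
      F (M + (M + r))           ≡⟨ cong F (trans (sym (+-assoc M M r)) (cong (_+ r) M+M≡2*M)) ⟩
      F (2 * M + r)             ≡⟨ digitSumsBelow-shift N 2 r r≤M ⟩
      F (2 * M) + 2 * r + F r   ≡⟨ cong (λ K → F K + 2 * r + F r) M+M≡2*M ⟨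
      F (M + M) + 2 * r + F r   ≡⟨ cong (λ z → z + 2 * r + F r) (digitSumsBelow-M+ M ≤-refl) ⟩
      F M + M + F M + 2 * r + F r ∎
      where
      open ≡-Reasoning
      M+M≡2*M : M + M ≡ 2 * M
      M+M≡2*M = cong (M +_) (sym (+-identityʳ M))

  segmentLayers : ∀ s → s ≤ 3 ^ suc N → SegmentLayers N s
  segmentLayers s s≤3M with s ≤? M
  ... | yes s≤M = record
    { s₀ = s ; s₁ = 0 ; s₂ = 0 ; s₂≤s₁ = z≤n ; s₁≤s₀ = z≤n ; s₀≤3^N = s≤M
    ; layer = λ { zero w → initialSegment-∷ s zero w
                ; (suc zero) w → offsetTo _ (suc zero) w (m≤n⇒m∸n≡0 s≤M)
                ; (suc (suc zero)) w → offsetTo _ (suc (suc zero)) w (m≤n⇒m∸n≡0 (≤-trans s≤M (m≤m+n M M))) }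
    ; sizes = +-identityʳ s
    ; digitSumsBelow-≤ = ≤-trans (m≤m+n (F s) 0) (m≤m+n (F s + 0) 0) }
  ... | no s≰M with m≤n⇒∃[o]m+o≡n (<⇒≤ (≰⇒> s≰M))
  ...   | r , refl with r ≤? M
  ...     | yes r≤M = record
    { s₀ = M ; s₁ = r ; s₂ = 0 ; s₂≤s₁ = z≤n ; s₁≤s₀ = r≤M ; s₀≤3^N = ≤-refl
    ; layer = λ { zero w → trans (initialSegment-∷ (M + r) zero w) (full w (m≤m+n M r))
                ; (suc zero) w → offsetTo _ (suc zero) w (m+n∸m≡n M r)
                ; (suc (suc zero)) w → offsetTo _ (suc (suc zero)) w (trans ([m+n]∸[m+o]≡n∸o M r M) (m≤n⇒m∸n≡0 r≤M)) }
    ; sizes = cong (M +_) (+-identityʳ r)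
    ; digitSumsBelow-≤ = ≤-reflexive (trans (digitSumsBelow-M+ r r≤M) (regroup (F M) r (F r))) }
    where
    regroup : ∀ f r g → f + r + g ≡ f + (g + 0) + (r + (0 + 0))
    regroup = solve-∀
  ...     | no r≰M with m≤n⇒∃[o]m+o≡n (<⇒≤ (≰⇒> r≰M))
  ...       | r′ , refl = record
    { s₀ = M ; s₁ = M ; s₂ = r′ ; s₂≤s₁ = r′≤M ; s₁≤s₀ = ≤-refl ; s₀≤3^N = ≤-refl
    ; layer = λ { zero w → trans (initialSegment-∷ (M + (M + r′)) zero w) (full w (m≤m+n M _))
                ; (suc zero) w → trans (offsetTo _ (suc zero) w (m+n∸m≡n M (M + r′)))
                                       (full w (m≤m+n M r′))
                ; (suc (suc zero)) w → offsetTo _ (suc (suc zero)) w (trans ([m+n]∸[m+o]≡n∸o M (M + r′) M) (m+n∸m≡n M r′)) }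
    ; sizes = refl
    ; digitSumsBelow-≤ = ≤-reflexive (trans (digitSumsBelow-M+M+ r′ r′≤M) (regroup (F M) M r′ (F r′))) }
    where
    r′≤M : r′ ≤ M
    r′≤M = +-cancelˡ-≤ M _ _ (+-cancelˡ-≤ M _ _ (subst (M + (M + r′) ≤_) (cong (λ k → M + (M + k)) (+-identityʳ M)) s≤3M))
    regroup : ∀ f M r g → f + M + f + 2 * r + g ≡ f + (f + g) + (M + (r + r))
    regroup = solve-∀

module _ {N s : ℕ} (L : SegmentLayers N s) where
  open SegmentLayers L

  segmentLayer-≤ : ∀ (x : Fin 3) → triad s₀ s₁ s₂ (toℕ x) ≤ 3 ^ N
  segmentLayer-≤ zero             = s₀≤3^N
  segmentLayer-≤ (suc zero)       = ≤-trans s₁≤s₀ s₀≤3^N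
  segmentLayer-≤ (suc (suc zero)) = ≤-trans s₂≤s₁ (≤-trans s₁≤s₀ s₀≤3^N)

size-initialSegment : ∀ N s → s ≤ 3 ^ N → size N (initialSegment s) ≡ s
size-initialSegment zero    0             _ = refl
size-initialSegment zero    1             _ = refl
size-initialSegment zero    (suc (suc _)) (s≤s ())
size-initialSegment (suc N) s s≤3^N = begin
  size (suc N) (initialSegment s)
    ≡⟨ sumVertices-suc N _ ⟩
  sumFin3 (λ x → size N (λ w → initialSegment s (x ∷ w)))
    ≡⟨ cong₂ _+_ (layerSize zero) (cong₂ _+_ (layerSize (suc zero)) (layerSize (suc (suc zero)))) ⟩
  s₀ + (s₁ + s₂)
    ≡⟨ sizes ⟩
  s ∎
  where
  open ≡-Reasoning
  L = segmentLayers N s s≤3^N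
  open SegmentLayers L
  layerSize : ∀ x → size N (λ w → initialSegment s (x ∷ w)) ≡ triad s₀ s₁ s₂ (toℕ x)
  layerSize x = trans (size-cong N (layer x)) (size-initialSegment N (triad s₀ s₁ s₂ (toℕ x)) (segmentLayer-≤ L x))

digitSumsBelow≤inducedEdges : ∀ N s → s ≤ 3 ^ N → digitSumsBelow s ≤ inducedEdges N (initialSegment s)
digitSumsBelow≤inducedEdges zero    0             _ = z≤n
digitSumsBelow≤inducedEdges zero    1             _ = z≤n
digitSumsBelow≤inducedEdges zero    (suc (suc _)) (s≤s ())
digitSumsBelow≤inducedEdges (suc N) s s≤3^N = begin
  digitSumsBelow s
    ≤⟨ digitSumsBelow-≤ ⟩
  digitSumsBelow s₀ + (digitSumsBelow s₁ + digitSumsBelow s₂) + (s₁ + (s₂ + s₂))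
    ≤⟨ +-mono-≤ (+-mono-≤ (inside zero) (+-mono-≤ (inside (suc zero)) (inside (suc (suc zero)))))
                (≤-reflexive (cong₂ _+_ (across zero (suc zero) s₁≤s₀)
                                        (cong₂ _+_ (across zero (suc (suc zero)) (≤-trans s₂≤s₁ s₁≤s₀))
                                                   (across (suc zero) (suc (suc zero)) s₂≤s₁)))) ⟩
  sumFin3 (within N W) + (between N W zero (suc zero) + (between N W zero (suc (suc zero)) + between N W (suc zero) (suc (suc zero))))
    ≡⟨ edgeSum-suc N W ⟨
  inducedEdges (suc N) (initialSegment s) ∎
  where
  open ≤-Reasoning
  L = segmentLayers N s s≤3^N
  open SegmentLayers L
  W : Vertex (suc N) → Vertex (suc N) → ℕ
  W u v = indicator (initialSegment s u ∧ initialSegment s v)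
  sizeOf : Fin 3 → ℕ
  sizeOf x = triad s₀ s₁ s₂ (toℕ x)
  inside : ∀ x → digitSumsBelow (sizeOf x) ≤ within N W x
  inside x = ≤-trans (digitSumsBelow≤inducedEdges N (sizeOf x) (segmentLayer-≤ L x)) (≤-reflexive (inducedEdges-cong N (sym ∘ layer x)))
  across : ∀ x y → sizeOf y ≤ sizeOf x → sizeOf y ≡ between N W x y
  across x y y≤x = sym (trans (size-cong N (λ w → trans (cong₂ _∧_ (layer x w) (layer y w)) (initialSegment-∧ w y≤x)))
                              (size-initialSegment N (sizeOf y) (segmentLayer-≤ L y)))

-- Wirelength on the caterpillar

column : ∀ {m} → TVertex m → ℕ
column (i , _) = toℕ i

pendant : ∀ {m} → TVertex m → ℕ
pendant (_ , a) = isLeaf a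

distT-distinct : ∀ {m} (p q : TVertex m) → p ≢ q → distT p q ≡ ∣ column p - column q ∣ + pendant p + pendant q
distT-distinct (i , a) (j , b) p≢q with i Fin.≟ j | a Fin.≟ b
... | yes refl | yes refl = contradiction refl p≢q
... | yes refl | no _     = refl
... | no _     | _        = refl

∣m-n∣+[m+n]≡2[m⊔n] : ∀ i j → ∣ i - j ∣ + (i + j) ≡ 2 * (i ⊔ j)
∣m-n∣+[m+n]≡2[m⊔n] zero    j       = cong (j +_) (sym (+-identityʳ j))
∣m-n∣+[m+n]≡2[m⊔n] (suc i) zero    = refl
∣m-n∣+[m+n]≡2[m⊔n] (suc i) (suc j) = begin
  ∣ i - j ∣ + (suc i + suc j)     ≡⟨ cong (∣ i - j ∣ +_) (cong suc (+-suc i j)) ⟩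
  ∣ i - j ∣ + suc (suc (i + j))   ≡⟨ +-suc _ _ ⟩
  suc (∣ i - j ∣ + suc (i + j))   ≡⟨ cong suc (+-suc _ _) ⟩
  2 + (∣ i - j ∣ + (i + j))       ≡⟨ cong (2 +_) (∣m-n∣+[m+n]≡2[m⊔n] i j) ⟩
  2 + 2 * (i ⊔ j)                 ≡⟨ *-suc 2 (i ⊔ j) ⟨
  2 * suc (i ⊔ j)                 ∎
  where open ≡-Reasoning

countAbove : ∀ k m → sumBelow m (λ t → indicator (does (k <? t))) ≡ m ∸ suc k
countAbove k zero    = refl
countAbove k (suc m) with k <? m
... | yes k<m = trans (cong₂ _+_ (countAbove k m) (cong indicator (dec-true (k <? m) k<m)))
                      (trans (+-comm _ 1) (sym (+-∸-assoc 1 k<m)))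
... | no  k≮m = trans (cong₂ _+_ (countAbove k m) (cong indicator (dec-false (k <? m) k≮m)))
                      (trans (+-identityʳ _) (trans (m≤n⇒m∸n≡0 (≤-trans (≮⇒≥ k≮m) (n≤1+n k)))
                                                    (sym (m≤n⇒m∸n≡0 (≮⇒≥ k≮m)))))

-- |i - j| = 2 (i ⊔ j) - i - j, and m - 1 - (i ⊔ j) of the t < m lie right of both columns i and j.
distT-columns : ∀ {m} (p q : TVertex m) → p ≢ q →
  distT p q + 2 * sumBelow m (λ t → indicator (does (column p <? t) ∧ does (column q <? t))) + (column p + column q) + 2
    ≡ 2 * m + (pendant p + pendant q)
distT-columns {m} p@(i′ , _) q@(j′ , _) p≢q = begin
  distT p q + 2 * sumBelow m both + (i + j) + 2
    ≡⟨ cong₂ (λ d s → d + 2 * s + (i + j) + 2) (distT-distinct p q p≢q)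
             (trans (sumBelow-cong m (λ t _ → cong indicator (both≡max t))) (countAbove c m)) ⟩
  ∣ i - j ∣ + pendant p + pendant q + 2 * (m ∸ suc c) + (i + j) + 2
    ≡⟨ regroup ∣ i - j ∣ (i + j) (pendant p) (pendant q) (m ∸ suc c) ⟩
  (∣ i - j ∣ + (i + j)) + 2 * (m ∸ suc c) + 2 + (pendant p + pendant q)
    ≡⟨ cong (λ x → x + 2 * (m ∸ suc c) + 2 + (pendant p + pendant q)) (∣m-n∣+[m+n]≡2[m⊔n] i j) ⟩
  2 * c + 2 * (m ∸ suc c) + 2 + (pendant p + pendant q)
    ≡⟨ regroup′ c (m ∸ suc c) (pendant p + pendant q) ⟩
  2 * (m ∸ suc c + suc c) + (pendant p + pendant q)
    ≡⟨ cong (λ x → 2 * x + (pendant p + pendant q)) (m∸n+n≡m (⊔-lub (toℕ<n i′) (toℕ<n j′))) ⟩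
  2 * m + (pendant p + pendant q) ∎
  where
  open ≡-Reasoning
  i = column p
  j = column q
  c = i ⊔ j
  both : ℕ → ℕ
  both t = indicator (does (i <? t) ∧ does (j <? t))
  both≡max : ∀ t → does (i <? t) ∧ does (j <? t) ≡ does (c <? t)
  both≡max t = does-⇔ (mk⇔ (λ (i<t , j<t) → ⊔-lub i<t j<t) (λ c<t → ≤-<-trans (m≤m⊔n i j) c<t , ≤-<-trans (m≤n⊔m i j) c<t))
                      (i <? t ×-dec j <? t) (c <? t)
  regroup : ∀ d s la lb r → d + la + lb + 2 * r + s + 2 ≡ (d + s) + 2 * r + 2 + (la + lb)
  regroup = solve-∀
  regroup′ : ∀ c r l → 2 * c + 2 * r + 2 + l ≡ 2 * (r + suc c) + l
  regroup′ = solve-∀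

columnsBelow : ∀ {n m} → (Vertex n → TVertex m) → ℕ → Vertex n → Bool
columnsBelow g t v = does (column (g v) <? t)

columnEdges : ∀ {n m} → (Vertex n → TVertex m) → ℕ
columnEdges {n} {m} g = sumBelow m (λ t → inducedEdges n (columnsBelow g t))

edgeCount : ℕ → ℕ
edgeCount n = edgeSum n (λ _ _ → 1)

wirelength-columnEdges : ∀ {n m} (g : Vertex n → TVertex m) → Injective _≡_ _≡_ g →
  WL g + 2 * columnEdges g + n * (2 * sumVertices n (column ∘ g)) + 2 * edgeCount n
    ≡ 2 * m * edgeCount n + n * (2 * sumVertices n (pendant ∘ g))
wirelength-columnEdges {n} {m} g g-injective = begin
  WL g + 2 * columnEdges g + n * (2 * sumVertices n (column ∘ g)) + 2 * E
    ≡⟨ cong₂ (λ x y → WL g + 2 * x + y + 2 * E) (edgeSum-sumBelow n m _) (edgeSum-handshake n (column ∘ g)) ⟨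
  WL g + 2 * edgeSum n S + C + 2 * E
    ≡⟨ cong₂ (λ x y → WL g + x + C + y) (edgeSum-* n 2 S) (edgeSum-* n 2 (λ _ _ → 1)) ⟨
  WL g + edgeSum n (λ u v → 2 * S u v) + C + edgeSum n (λ _ _ → 2)
    ≡⟨ cong (λ x → x + C + edgeSum n (λ _ _ → 2)) (edgeSum-+ n _ _) ⟨
  edgeSum n (λ u v → distT (g u) (g v) + 2 * S u v) + C + edgeSum n (λ _ _ → 2)
    ≡⟨ cong (_+ edgeSum n (λ _ _ → 2)) (edgeSum-+ n _ _) ⟨
  edgeSum n (λ u v → distT (g u) (g v) + 2 * S u v + (column (g u) + column (g v))) + edgeSum n (λ _ _ → 2)
    ≡⟨ edgeSum-+ n _ _ ⟨
  edgeSum n (λ u v → distT (g u) (g v) + 2 * S u v + (column (g u) + column (g v)) + 2)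
    ≡⟨ edgeSum-cong n (λ u v u≢v → distT-columns (g u) (g v) (u≢v ∘ g-injective)) ⟩
  edgeSum n (λ u v → 2 * m + (pendant (g u) + pendant (g v)))
    ≡⟨ edgeSum-+ n _ _ ⟩
  edgeSum n (λ _ _ → 2 * m) + edgeSum n (λ u v → pendant (g u) + pendant (g v))
    ≡⟨ cong₂ _+_ (trans (edgeSum-cong n (λ _ _ _ → sym (*-identityʳ (2 * m)))) (edgeSum-* n (2 * m) _))
                 (edgeSum-handshake n (pendant ∘ g)) ⟩
  2 * m * E + n * (2 * sumVertices n (pendant ∘ g)) ∎
  where
  open ≡-Reasoning
  E = edgeCount n
  C = edgeSum n (λ u v → column (g u) + column (g v))
  S : Vertex n → Vertex n → ℕ
  S u v = sumBelow m (λ t → indicator (columnsBelow g t u ∧ columnsBelow g t v))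

wirelength+columnEdges-invariant : ∀ {n m} (f g : Vertex n ⤖ TVertex m) →
  WL (Bijection.to f) + 2 * columnEdges (Bijection.to f) ≡ WL (Bijection.to g) + 2 * columnEdges (Bijection.to g)
wirelength+columnEdges-invariant {n} {m} f g = +-cancelʳ-≡ K _ _ (+-cancelʳ-≡ (2 * E) _ _ (begin
  WL F.to + 2 * columnEdges F.to + K + 2 * E
    ≡⟨ wirelength-columnEdges F.to F.injective ⟩
  2 * m * E + n * (2 * sumVertices n (pendant ∘ F.to))
    ≡⟨ cong (λ x → 2 * m * E + n * (2 * x)) (sumVertices-bijection f g pendant) ⟩
  2 * m * E + n * (2 * sumVertices n (pendant ∘ G.to))
    ≡⟨ wirelength-columnEdges G.to G.injective ⟨
  WL G.to + 2 * columnEdges G.to + n * (2 * sumVertices n (column ∘ G.to)) + 2 * E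
    ≡⟨ cong (λ x → WL G.to + 2 * columnEdges G.to + n * (2 * x) + 2 * E) (sumVertices-bijection f g column) ⟨
  WL G.to + 2 * columnEdges G.to + K + 2 * E ∎))
  where
  open ≡-Reasoning
  module F = Bijection f
  module G = Bijection g
  E = edgeCount n
  K = n * (2 * sumVertices n (column ∘ F.to))

value-∷ʳ : ∀ {k} (ys : Vertex k) y → value (ys ∷ʳ y) ≡ 3 * value ys + toℕ y
value-∷ʳ []       y = trans (toℕ-combine y zero) (trans (+-identityʳ _) (*-identityˡ (toℕ y)))
value-∷ʳ {suc k} (x ∷ ys) y = begin
  value (x ∷ (ys ∷ʳ y))                      ≡⟨ toℕ-combine x (toFin3 (ys ∷ʳ y)) ⟩
  3 ^ suc k * toℕ x + value (ys ∷ʳ y)        ≡⟨ cong (3 ^ suc k * toℕ x +_) (value-∷ʳ ys y) ⟩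
  3 ^ suc k * toℕ x + (3 * value ys + toℕ y) ≡⟨ regroup (3 ^ k) (toℕ x) (value ys) (toℕ y) ⟩
  3 * (3 ^ k * toℕ x + value ys) + toℕ y     ≡⟨ cong (λ z → 3 * z + toℕ y) (toℕ-combine x (toFin3 ys)) ⟨
  3 * value (x ∷ ys) + toℕ y                 ∎
  where
  open ≡-Reasoning
  regroup : ∀ M x v y → 3 * M * x + (3 * v + y) ≡ 3 * (M * x + v) + y
  regroup = solve-∀

value-init-last : ∀ {k} (v : Vertex (suc k)) → value v ≡ 3 * value (init v) + toℕ (last v)
value-init-last v = trans (cong value (proj₂ (proj₂ (initLast v)))) (value-∷ʳ (init v) (last v))

toFin3-injective : ∀ {k} → Injective _≡_ _≡_ (toFin3 {k})
toFin3-injective {x = []}    {[]}    _ = refl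
toFin3-injective {x = x ∷ u} {y ∷ v} eq =
  cong₂ _∷_ (combine-injectiveˡ x (toFin3 u) y (toFin3 v) eq) (toFin3-injective (combine-injectiveʳ x (toFin3 u) y (toFin3 v) eq))

toFin3-surjective : ∀ k → StrictlySurjective _≡_ (toFin3 {k})
toFin3-surjective zero    zero = [] , refl
toFin3-surjective (suc k) i with remQuot {3} (3 ^ k) i in eq
... | x , j with toFin3-surjective k j
...   | v , refl = x ∷ v , trans (cong (λ p → combine (proj₁ p) (proj₂ p)) (sym eq)) (combine-remQuot {3} (3 ^ k) i)

lex-bijection : ∀ {k} → Vertex (suc k) ⤖ TVertex (3 ^ k)
lex-bijection {k} = mk⤖ (lex-injective , strictlySurjective⇒surjective lex-surjective)
  where
  lex-injective : Injective _≡_ _≡_ (lex {k})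
  lex-injective {u} {v} eq = begin
    u                   ≡⟨ proj₂ (proj₂ (initLast u)) ⟩
    init u ∷ʳ last u    ≡⟨ cong₂ _∷ʳ_ (toFin3-injective (cong proj₁ eq)) (cong proj₂ eq) ⟩
    init v ∷ʳ last v    ≡⟨ proj₂ (proj₂ (initLast v)) ⟨
    v                   ∎
    where open ≡-Reasoning
  lex-surjective : StrictlySurjective _≡_ (lex {k})
  lex-surjective (i , a) with toFin3-surjective k i
  ... | v , refl = v ∷ʳ a , cong₂ _,_ (cong toFin3 (init-∷ʳ a v)) (last-∷ʳ a v)

columnsBelow-lex : ∀ {k} t (v : Vertex (suc k)) → columnsBelow lex t v ≡ initialSegment (3 * t) v
columnsBelow-lex t v = does-⇔ (mk⇔ q<t⇒v<3t v<3t⇒q<t) (q <? t) (value v <? 3 * t)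
  where
  q = value (init v)
  e = toℕ (last v)
  q<t⇒v<3t : q < t → value v < 3 * t
  q<t⇒v<3t q<t = subst (_< 3 * t) (sym (value-init-last v)) (begin-strict
    3 * q + e   <⟨ +-monoʳ-< (3 * q) (toℕ<n (last v)) ⟩
    3 * q + 3   ≡⟨ trans (+-comm (3 * q) 3) (sym (*-suc 3 q)) ⟩
    3 * suc q   ≤⟨ *-monoʳ-≤ 3 q<t ⟩
    3 * t       ∎)
    where open ≤-Reasoning
  v<3t⇒q<t : value v < 3 * t → q < t
  v<3t⇒q<t v<3t = *-cancelˡ-< 3 q t (≤-<-trans (m≤m+n (3 * q) e) (subst (_< 3 * t) (value-init-last v) v<3t))

columnEdges≤columnEdges-lex : ∀ k (f : Vertex (suc k) ⤖ TVertex (3 ^ k)) → columnEdges (Bijection.to f) ≤ columnEdges (lex {k})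
columnEdges≤columnEdges-lex k f = sumBelow-mono (3 ^ k) λ t t<3^k →
  let 3t≤3^N = *-monoʳ-≤ 3 (<⇒≤ t<3^k) in begin
  inducedEdges N (columnsBelow F t)                     ≤⟨ inducedEdges≤digitSumsBelow N (columnsBelow F t) ⟩
  digitSumsBelow (size N (columnsBelow F t))            ≡⟨ cong digitSumsBelow (size-columnsBelow t 3t≤3^N) ⟩
  digitSumsBelow (3 * t)                                ≤⟨ digitSumsBelow≤inducedEdges N (3 * t) 3t≤3^N ⟩
  inducedEdges N (initialSegment (3 * t))               ≡⟨ inducedEdges-cong N (columnsBelow-lex t) ⟨
  inducedEdges N (columnsBelow lex t)                   ∎
  where
  open ≤-Reasoning
  N = suc k
  F = Bijection.to f
  size-columnsBelow : ∀ t → 3 * t ≤ 3 ^ N → size N (columnsBelow F t) ≡ 3 * t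
  size-columnsBelow t 3t≤3^N = begin-equality
    size N (columnsBelow F t)                ≡⟨ sumVertices-bijection f lex-bijection (λ p → indicator (does (column p <? t))) ⟩
    size N (columnsBelow lex t)              ≡⟨ size-cong N (columnsBelow-lex t) ⟩
    size N (initialSegment (3 * t))          ≡⟨ size-initialSegment N (3 * t) 3t≤3^N ⟩
    3 * t                                    ∎

lemma5p3 : (k : ℕ) (f : Vertex (suc k) ⤖ TVertex (3 ^ k)) →
           WL {suc k} {3 ^ k} lex ≤ WL {suc k} {3 ^ k} (Bijection.to f)
lemma5p3 k f = +-cancelʳ-≤ (2 * columnEdges L) (WL L) (WL F) (begin
  WL L + 2 * columnEdges L   ≡⟨ wirelength+columnEdges-invariant lex-bijection f ⟩
  WL F + 2 * columnEdges F   ≤⟨ +-monoʳ-≤ (WL F) (*-monoʳ-≤ 2 (columnEdges≤columnEdges-lex k f)) ⟩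
  WL F + 2 * columnEdges L   ∎)
  where
  open ≤-Reasoning
  L F : Vertex (suc k) → TVertex (3 ^ k)
  L = lex
  F = Bijection.to f
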